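{- Let $n$ be an odd squarefree integer with $\Omega(n)\geq 3$ all of whose prime divisors are at least $7$. Then a sequence in $\mathbb{Z}_n$ is an $S(n)$-extremal sequence for the Davenport constant if and only if it is a $U(n)$-extremal sequence for the Davenport constant.
   Context: $\mathbb{Z}_n=\mathbb{Z}/n\mathbb{Z}$, $U(n)$ its unit group. For nonempty $A\subseteq\mathbb{Z}_n\setminus\{0\}$, a sequence $(x_1,\ldots,x_l)$ is an $A$-weighted zero-sum sequence if $a_1x_1+\cdots+a_lx_l=0$ for some $a_i\in A$; subsequences are nonempty. $D_A(n)$ is the least $k$ such that every sequence of length $k$ in $\mathbb{Z}_n$ has an $A$-weighted zero-sum subsequence; an $A$-extremal sequence for the Davenport constant is a sequence of length $D_A(n)-1$ with no $A$-weighted zero-sum subsequence. $\Omega(n)$ counts prime factors with multiplicity. For odd $n=\prod p_i^{r_i}$ and $a\in U(n)$, $\left(\frac{a}{n}\right)=\prod_i\left(\frac{a\bmod p_i}{p_i}\right)^{r_i}$ (Legendre symbols), and $S(n)$ is the kernel of $a\mapsto\left(\frac{a}{n}\right)$ on $U(n)$. -}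

module Defs where

open import Data.Bool using (Bool; true; false; if_then_else_)
open import Data.Nat using (ℕ; zero; suc; _+_; _*_; _≤_; _≡ᵇ_)
open import Data.Nat.DivMod using (_%_)
open import Data.Nat.Divisibility using (_∣_)
open import Data.Nat.Primality using (Prime)
open import Data.Nat.Coprimality using (Coprime)
open import Data.Integer as ℤ using (ℤ; 1ℤ; -1ℤ)
open import Data.Fin using (Fin; toℕ)
open import Data.List using (List; []; map; foldr; length; zipWith; upTo)
open import Data.Nat.ListAction using (sum; product)
open import Data.Bool.ListAction using (any)
open import Data.List.Relation.Unary.All using (All)
open import Data.List.Relation.Binary.Sublist.Propositional using (_⊆_)
open import Data.Product using (Σ; ∃; _×_)
open import Relation.Binary.PropositionalEquality using (_≡_; _≢_)
open import Relation.Nullary using (¬_)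

-- Subsets of ℤ_n (elements of ℤ_n are represented by Fin n, i.e. residues 0..n-1).
Subset : ℕ → Set₁
Subset n = Fin n → Set

IsFactorisation : ℕ → List ℕ → Set
IsFactorisation n ps = All Prime ps × product ps ≡ n

ΩAtLeast : ℕ → ℕ → Set
ΩAtLeast k n = ∃ λ ps → IsFactorisation n ps × k ≤ length ps

Odd : ℕ → Set
Odd n = ¬ (2 ∣ n)

Squarefree : ℕ → Set
Squarefree n = ∀ p → Prime p → ¬ (p * p ∣ n)

isQR : ℕ → ℕ → Bool
isQR a zero = false
isQR a (suc m) = any (λ x → ((x * x) % suc m) ≡ᵇ (a % suc m)) (upTo (suc m))

-- Legendre symbol (a/p) for a coprime to the prime p: +1 if a is a square mod p, else -1.
legendre : ℕ → ℕ → ℤ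
legendre a p = if isQR a p then 1ℤ else -1ℤ

-- Jacobi symbol (a/n) = ∏ (a/p_i) over a prime factorisation of n listed with multiplicity
-- (so each p_i occurs r_i times, giving the exponent r_i).
jacobiOver : ℕ → List ℕ → ℤ
jacobiOver a ps = foldr ℤ._*_ 1ℤ (map (legendre a) ps)

U : (n : ℕ) → Subset n
U n a = Coprime (toℕ a) n

S : (n : ℕ) → Subset n
S n a = U n a × (∀ ps → IsFactorisation n ps → jacobiOver (toℕ a) ps ≡ 1ℤ)

WeightedZeroSum : (n : ℕ) → Subset n → List (Fin n) → Set
WeightedZeroSum n A xs =
  ∃ λ (ws : List (Fin n)) → All A ws × length ws ≡ length xs
    × n ∣ sum (zipWith (λ w x → toℕ w * toℕ x) ws xs)

HasWZSSub : (n : ℕ) → Subset n → List (Fin n) → Set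
HasWZSSub n A xs = ∃ λ ys → ys ⊆ xs × ys ≢ [] × WeightedZeroSum n A ys

AllOfLengthHave : (n : ℕ) → Subset n → ℕ → Set
AllOfLengthHave n A k = ∀ (xs : List (Fin n)) → length xs ≡ k → HasWZSSub n A xs

IsDavenport : (n : ℕ) → Subset n → ℕ → Set
IsDavenport n A d = AllOfLengthHave n A d × (∀ k → AllOfLengthHave n A k → d ≤ k)

Extremal : (n : ℕ) → Subset n → List (Fin n) → Set
Extremal n A xs = ∃ λ d → IsDavenport n A d × length xs + 1 ≡ d × ¬ HasWZSSub n A xs

-- Write n = q₁ ⋯ q_k with distinct primes qᵢ ≥ 7 and k ≥ 3; both Davenport constants turn out to be
-- k + 1. The sequence 1, q₁, q₁q₂, … of length k has no U(n)-weighted zero-sum subsequence: in every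
-- nonempty subsequence some prime divides all terms but one, and a unit-weighted zero sum forbids that.
-- Conversely, among k + 1 terms the patterns (qᵢ ∤ x)ᵢ are linearly dependent over GF(2), giving a
-- subsequence in which no prime divides all terms but one. Modulo each prime we then find unit weights
-- with prescribed quadratic characters and vanishing weighted sum (qᵢ ≥ 7 makes 1 = u + v solvable for
-- every choice of the characters of u and v), choosing the characters so that every weight has Jacobi
-- symbol 1, and glue them by the Chinese remainder theorem into weights in S(n). The same construction
-- turns a U(n)-weighted zero-sum subsequence of a sequence of length k into an S(n)-weighted one.

module Submission where

open import Algebra.Bundles using (CommutativeMonoid; AbelianGroup; CommutativeRing)
import Algebra.Properties.CommutativeSemigroup as CommutativeSemigroupProperties
open import Data.Bool using (Bool; true; false; not; _xor_; _∧_; if_then_else_; T; T?)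
open import Data.Bool.ListAction using (any; or)
open import Data.Bool.Properties using (T-≡; not-injective)
import Data.Bool.Properties as Bool
open import Data.Empty using (⊥; ⊥-elim)
open import Data.Fin using (Fin; zero; suc; toℕ)
import Data.Fin.Properties as Fin
open import Data.Integer as ℤ using (ℤ; 1ℤ; -1ℤ)
import Data.Integer.Properties as ℤ
open import Data.List using (List; []; _∷_; _++_; length; map; foldr; replicate; take; lookup; zipWith; tabulate; upTo; applyUpTo; filterᵇ)
open import Data.List.Membership.Propositional using (_∈_; lose; find)
open import Data.List.Membership.Propositional.Properties
  using (∈-lookup; ∈-upTo⁺; ∈-applyUpTo⁺; ∈-applyUpTo⁻; ∈-∃++; ∈-++⁻; ∈-++⁺ˡ; ∈-++⁺ʳ; ∈-map⁺; ∈-map⁻; ∈-filter⁺; ∈-filter⁻)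
open import Data.List.Properties using (length-++; length-map; length-applyUpTo; length-tabulate; length-replicate; length-take)
open import Data.List.Relation.Binary.Permutation.Propositional
  using (_↭_) renaming (refl to ↭-refl; prep to ↭-prep; swap to ↭-swap; trans to ↭-trans)
open import Data.List.Relation.Binary.Sublist.Propositional using (_⊆_; []; _∷_; _∷ʳ_; minimum; from∈; ⊆-trans)
open import Data.List.Relation.Binary.Sublist.Propositional.Properties using (All-resp-⊆; take-⊆)
open import Data.List.Relation.Unary.All using (All; []; _∷_)
import Data.List.Relation.Unary.All as All
import Data.List.Relation.Unary.All.Properties as AllP
open import Data.List.Relation.Unary.Any using (Any; here; there; satisfied; index)
import Data.List.Relation.Unary.Any as Any
open import Data.List.Relation.Unary.Any.Properties using (any⁺; any⁻; lookup-index)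
open import Data.List.Relation.Unary.Unique.Propositional using (Unique; []; _∷_)
import Data.List.Relation.Unary.Unique.Propositional.Properties as Unique
open import Data.Maybe using (Maybe; just; nothing)
import Data.Maybe as Maybe
open import Data.Nat hiding (parity)
open import Data.Nat.Coprimality using (Coprime; coprime-Bézout; coprime-divisor; prime⇒coprime)
import Data.Nat.Coprimality as Coprime
open import Data.Nat.Divisibility
open import Data.Nat.DivMod
import Data.Nat.GCD as GCD
open import Data.Nat.ListAction using (sum; product)
open import Data.Nat.ListAction.Properties using (∈⇒∣product)
open import Data.Nat.Primality
open import Data.Nat.Primality.Factorisation using (PrimeFactorisation; factorise; factorisationUnique; factorisationHasAllPrimeFactors)
open import Data.Nat.Properties
open import Data.Nat.Tactic.RingSolver using (solve-∀)
open import Data.Product using (∃; ∃₂; _×_; _,_; proj₁; proj₂)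
open import Data.Sum using (_⊎_; inj₁; inj₂)
open import Data.Vec.Functional using (updateAt; tail)
import Data.Vec.Functional as Vec
open import Data.Vec.Functional.Properties using (updateAt-updates; updateAt-minimal)
open import Function using (_∘_; id; const; Equivalence)
open import Level using (0ℓ)
open import Relation.Binary.Bundles using (Setoid)
open import Relation.Binary.Definitions using (tri<; tri≈; tri>)
open import Relation.Binary.PropositionalEquality
import Relation.Binary.Reasoning.Setoid as SetoidReasoning
open import Relation.Binary.Structures using (IsEquivalence)
open import Relation.Nullary
open import Relation.Nullary.Decidable using (True; toWitness; ¬?; _×-dec_)

open import Defs

open import Algebra.Properties.CommutativeMonoid.Sum +-0-commutativeMonoid using () renaming (sum to ∑)
import Algebra.Properties.CommutativeSemigroup +-commutativeSemigroup as +-CS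
import Algebra.Properties.CommutativeSemigroup *-commutativeSemigroup as *-CS
module ℤ-*-CS = CommutativeSemigroupProperties (CommutativeMonoid.commutativeSemigroup ℤ.*-1-commutativeMonoid)

private variable
  A B : Set

-- Arithmetic modulo a prime

∣∧<⇒≡0 : ∀ {m d} → m ∣ d → d < m → d ≡ 0
∣∧<⇒≡0 {d = zero}  _   _   = refl
∣∧<⇒≡0 {d = suc d} m∣d d<m = ⊥-elim (<⇒≱ d<m (∣⇒≤ m∣d))

module Congruence (p : ℕ) .{{_ : NonZero p}} where

  infix 4 _≈_
  record _≈_ (a b : ℕ) : Set where
    constructor mk≈
    field ≈⇒%≡ : a % p ≡ b % p
  open _≈_ public

  ≈-isEquivalence : IsEquivalence _≈_
  ≈-isEquivalence = record
    { refl  = mk≈ refl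
    ; sym   = λ (mk≈ e) → mk≈ (sym e)
    ; trans = λ (mk≈ e) (mk≈ f) → mk≈ (trans e f)
    }

  ≈-setoid : Setoid 0ℓ 0ℓ
  ≈-setoid = record { isEquivalence = ≈-isEquivalence }

  open IsEquivalence ≈-isEquivalence public
    using () renaming (refl to ≈-refl; sym to ≈-sym; trans to ≈-trans; reflexive to ≡⇒≈)

  module ≈-Reasoning = SetoidReasoning ≈-setoid

  mod-≈ : ∀ a → a % p ≈ a
  mod-≈ a = mk≈ (m%n%n≡m%n a p)

  +-cong : ∀ {a b c d} → a ≈ b → c ≈ d → a + c ≈ b + d
  +-cong {a} {b} {c} {d} (mk≈ a≈b) (mk≈ c≈d) = mk≈ (begin
    (a + c) % p          ≡⟨ %-distribˡ-+ a c p ⟩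
    (a % p + c % p) % p  ≡⟨ cong₂ (λ x y → (x + y) % p) a≈b c≈d ⟩
    (b % p + d % p) % p  ≡⟨ %-distribˡ-+ b d p ⟨
    (b + d) % p          ∎)
    where open ≡-Reasoning

  *-cong : ∀ {a b c d} → a ≈ b → c ≈ d → a * c ≈ b * d
  *-cong {a} {b} {c} {d} (mk≈ a≈b) (mk≈ c≈d) = mk≈ (begin
    (a * c) % p            ≡⟨ %-distribˡ-* a c p ⟩
    (a % p * (c % p)) % p  ≡⟨ cong₂ (λ x y → (x * y) % p) a≈b c≈d ⟩
    (b % p * (d % p)) % p  ≡⟨ %-distribˡ-* b d p ⟨
    (b * d) % p            ∎)
    where open ≡-Reasoning

  +-congˡ : ∀ a {b c} → b ≈ c → a + b ≈ a + c
  +-congˡ a = +-cong (≈-refl {a})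

  +-congʳ : ∀ c {a b} → a ≈ b → a + c ≈ b + c
  +-congʳ c a≈b = +-cong a≈b (≈-refl {c})

  *-congˡ : ∀ a {b c} → b ≈ c → a * b ≈ a * c
  *-congˡ a = *-cong (≈-refl {a})

  *-congʳ : ∀ c {a b} → a ≈ b → a * c ≈ b * c
  *-congʳ c a≈b = *-cong a≈b (≈-refl {c})

  ∑-cong : ∀ {m} {f g : Fin m → ℕ} → (∀ j → f j ≈ g j) → ∑ f ≈ ∑ g
  ∑-cong {zero}  _   = ≈-refl
  ∑-cong {suc m} f≈g = +-cong (f≈g zero) (∑-cong (f≈g ∘ suc))

  ∑≈0 : ∀ {m} {f : Fin m → ℕ} → (∀ j → f j ≈ 0) → ∑ f ≈ 0
  ∑≈0 {zero}  _   = ≈-refl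
  ∑≈0 {suc m} f≈0 = +-cong (f≈0 zero) (∑≈0 (f≈0 ∘ suc))

  ∣⇒≈0 : ∀ {a} → p ∣ a → a ≈ 0
  ∣⇒≈0 {a} p∣a = mk≈ (trans (n∣m⇒m%n≡0 a p p∣a) (sym (m*n%n≡0 0 p)))

  ≈0⇒∣ : ∀ {a} → a ≈ 0 → p ∣ a
  ≈0⇒∣ {a} (mk≈ a≈0) = m%n≡0⇒n∣m a p (trans a≈0 (m*n%n≡0 0 p))

  m+kp≈m : ∀ m k → m + k * p ≈ m
  m+kp≈m m k = mk≈ ([m+kn]%n≡m%n m k p)

  neg : ℕ → ℕ
  neg a = p ∸ a % p

  +-neg≈0 : ∀ a → a + neg a ≈ 0
  +-neg≈0 a = ∣⇒≈0 (divides (suc (a / p)) a+neg≡)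
    where
    open ≡-Reasoning
    a+neg≡ : a + (p ∸ a % p) ≡ p + a / p * p
    a+neg≡ = begin
      a + (p ∸ a % p)                    ≡⟨ cong (_+ (p ∸ a % p)) (m≡m%n+[m/n]*n a p) ⟩
      a % p + a / p * p + (p ∸ a % p)    ≡⟨ +-CS.xy∙z≈y∙xz (a % p) (a / p * p) (p ∸ a % p) ⟩
      a / p * p + (a % p + (p ∸ a % p))  ≡⟨ cong (a / p * p +_) (m+[n∸m]≡n (m%n≤n a p)) ⟩
      a / p * p + p                      ≡⟨ +-comm (a / p * p) p ⟩
      p + a / p * p                      ∎

isQR⇒square : ∀ a q .{{_ : NonZero q}} → isQR a q ≡ true → ∃ λ x → (x * x) % q ≡ a % q
isQR⇒square a (suc m) qr
  with x , x²≡a ← satisfied (any⁻ (λ x → (x * x) % suc m ≡ᵇ a % suc m) (upTo (suc m)) (Equivalence.from T-≡ qr))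
  = x , ≡ᵇ⇒≡ _ _ x²≡a

square⇒isQR : ∀ a q .{{_ : NonZero q}} x → (x * x) % q ≡ a % q → isQR a q ≡ true
square⇒isQR a (suc m) x x²≡a = Equivalence.to T-≡ (any⁺ check (lose (∈-upTo⁺ (m%n<n x (suc m))) (≡⇒≡ᵇ _ _ y²≡a)))
  where
  open Congruence (suc m)
  check : ℕ → Bool
  check y = (y * y) % suc m ≡ᵇ a % suc m
  y²≡a : (x % suc m * (x % suc m)) % suc m ≡ a % suc m
  y²≡a = trans (≈⇒%≡ (*-cong (mod-≈ x) (mod-≈ x))) x²≡a

isQR-resp-% : ∀ a b q .{{_ : NonZero q}} → a % q ≡ b % q → isQR a q ≡ isQR b q
isQR-resp-% a b (suc m) a≈b = cong (λ r → any (λ x → (x * x) % suc m ≡ᵇ r) (upTo (suc m))) a≈b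

module PrimeModulus {p : ℕ} (prime : Prime p) where

  instance
    p≢0 : NonZero p
    p≢0 = prime⇒nonZero prime

  open Congruence p {{p≢0}} public

  1<p : 1 < p
  1<p = nonTrivial⇒n>1 p {{prime⇒nonTrivial prime}}

  Unit : ℕ → Set
  Unit a = ¬ (p ∣ a)

  *-Unit : ∀ {a b} → Unit a → Unit b → Unit (a * b)
  *-Unit {a} {b} ua ub p∣ab with euclidsLemma a b prime p∣ab
  ... | inj₁ p∣a = ua p∣a
  ... | inj₂ p∣b = ub p∣b

  Unit-resp-≈ : ∀ {a b} → a ≈ b → Unit a → Unit b
  Unit-resp-≈ a≈b ua p∣b = ua (≈0⇒∣ (≈-trans a≈b (∣⇒≈0 p∣b)))

  Unit-1 : Unit 1
  Unit-1 p∣1 = <⇒≱ 1<p (∣⇒≤ p∣1)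

  0<x<p⇒Unit : ∀ {x} → 0 < x → x < p → Unit x
  0<x<p⇒Unit 0<x x<p p∣x = >⇒≢ 0<x (∣∧<⇒≡0 p∣x x<p)

  Unit⇒%≢0 : ∀ {a} → Unit a → a % p ≢ 0
  Unit⇒%≢0 {a} ua a%p≡0 = ua (m%n≡0⇒n∣m a p a%p≡0)

  <p∧≈⇒≡ : ∀ {x y} → x < p → y < p → x ≈ y → x ≡ y
  <p∧≈⇒≡ x<p y<p (mk≈ x≈y) = trans (sym (m<n⇒m%n≡m x<p)) (trans x≈y (m<n⇒m%n≡m y<p))

  neg-Unit : ∀ {x} → Unit x → Unit (neg x)
  neg-Unit {x} ux p∣-x = ux (≈0⇒∣ (begin
    x          ≡⟨ +-identityʳ x ⟨
    x + 0      ≈⟨ +-congˡ x (∣⇒≈0 p∣-x) ⟨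
    x + neg x  ≈⟨ +-neg≈0 x ⟩
    0          ∎))
    where open ≈-Reasoning

  +-cancelˡ-≈ : ∀ {a b c} → a + b ≈ a + c → b ≈ c
  +-cancelˡ-≈ {a} {b} {c} a+b≈a+c = begin
    b                  ≈⟨ +-congʳ b (+-neg≈0 a) ⟨
    a + neg a + b      ≡⟨ +-CS.xy∙z≈y∙xz a (neg a) b ⟩
    neg a + (a + b)    ≈⟨ +-congˡ (neg a) a+b≈a+c ⟩
    neg a + (a + c)    ≡⟨ +-CS.xy∙z≈y∙xz a (neg a) c ⟨
    a + neg a + c      ≈⟨ +-congʳ c (+-neg≈0 a) ⟩
    c                  ∎
    where open ≈-Reasoning

  [p∸1]²≈1 : (p ∸ 1) * (p ∸ 1) ≈ 1
  [p∸1]²≈1 = ≈-trans (≡⇒≈ (square-pred p 1<p)) (m+kp≈m 1 (p ∸ 2))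
    where
    square-pred : ∀ q → 1 < q → (q ∸ 1) * (q ∸ 1) ≡ 1 + (q ∸ 2) * q
    square-pred (suc zero)    (s≤s ())
    square-pred (suc (suc j)) _ = identity j
      where
      identity : ∀ j → suc j * suc j ≡ 1 + j * suc (suc j)
      identity = solve-∀

  +1≈0⇒≈p∸1 : ∀ z → z + 1 ≈ 0 → z ≈ p ∸ 1
  +1≈0⇒≈p∸1 z z+1≈0 = begin
    z                ≈⟨ m+kp≈m z 1 ⟨
    z + 1 * p        ≡⟨ cong (z +_) (trans (*-identityˡ p) (sym (m+[n∸m]≡n (<⇒≤ 1<p)))) ⟩
    z + (1 + (p ∸ 1)) ≡⟨ +-assoc z 1 (p ∸ 1) ⟨
    z + 1 + (p ∸ 1)  ≈⟨ +-congʳ (p ∸ 1) z+1≈0 ⟩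
    p ∸ 1            ∎
    where open ≈-Reasoning

  inverse : ∀ {a} → Unit a → ∃ λ b → a * b ≈ 1
  inverse {a} ua with coprime-Bézout (Coprime.sym (prime⇒coprime prime {{≢-nonZero (Unit⇒%≢0 ua)}} (m%n<n a p)))
  ... | GCD.Bézout.+- x y eq = x , (begin
    a * x          ≈⟨ *-congʳ x (mod-≈ a) ⟨
    a % p * x      ≡⟨ *-comm (a % p) x ⟩
    x * (a % p)    ≡⟨ eq ⟨
    1 + y * p      ≈⟨ m+kp≈m 1 y ⟩
    1              ∎)
    where open ≈-Reasoning
  ... | GCD.Bézout.-+ x y eq = x * (p ∸ 1) , (begin
    a * (x * (p ∸ 1))    ≡⟨ *-assoc a x (p ∸ 1) ⟨
    a * x * (p ∸ 1)      ≈⟨ *-congʳ (p ∸ 1) (+1≈0⇒≈p∸1 (a * x) ax+1≈0) ⟩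
    (p ∸ 1) * (p ∸ 1)    ≈⟨ [p∸1]²≈1 ⟩
    1                    ∎)
    where
    open ≈-Reasoning
    ax+1≈0 : a * x + 1 ≈ 0
    ax+1≈0 = begin
      a * x + 1        ≈⟨ +-congʳ 1 (*-congʳ x (mod-≈ a)) ⟨
      a % p * x + 1    ≡⟨ +-comm (a % p * x) 1 ⟩
      1 + a % p * x    ≡⟨ cong (1 +_) (*-comm (a % p) x) ⟩
      1 + x * (a % p)  ≡⟨ eq ⟩
      y * p            ≈⟨ ∣⇒≈0 (n∣m*n y) ⟩
      0                ∎

  inverse⇒Unit : ∀ {a b} → a * b ≈ 1 → Unit b
  inverse⇒Unit {a} ab≈1 p∣b = Unit-1 (≈0⇒∣ (≈-trans (≈-sym ab≈1) (∣⇒≈0 (∣n⇒∣m*n a p∣b))))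

  *-cancelˡ-≈ : ∀ {a x y} → Unit a → a * x ≈ a * y → x ≈ y
  *-cancelˡ-≈ {a} {x} {y} ua ax≈ay with b , ab≈1 ← inverse ua = begin
    x            ≡⟨ *-identityˡ x ⟨
    1 * x        ≈⟨ *-congʳ x ab≈1 ⟨
    a * b * x    ≡⟨ *-CS.xy∙z≈y∙xz a b x ⟩
    b * (a * x)  ≈⟨ *-congˡ b ax≈ay ⟩
    b * (a * y)  ≡⟨ *-CS.xy∙z≈y∙xz a b y ⟨
    a * b * y    ≈⟨ *-congʳ y ab≈1 ⟩
    1 * y        ≡⟨ *-identityˡ y ⟩
    y            ∎
    where open ≈-Reasoning

  χ : ℕ → Bool
  χ a = isQR a p

  χ-resp-≈ : ∀ {a b} → a ≈ b → χ a ≡ χ b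
  χ-resp-≈ {a} {b} (mk≈ a≈b) = isQR-resp-% a b p a≈b

  χ-square : ∀ x → χ (x * x) ≡ true
  χ-square x = square⇒isQR (x * x) p x refl

  square≈⇒χ : ∀ {a} x → x * x ≈ a → χ a ≡ true
  square≈⇒χ x x²≈a = trans (sym (χ-resp-≈ x²≈a)) (χ-square x)

  χ⇒square : ∀ {a} → χ a ≡ true → ∃ λ x → x * x ≈ a
  χ⇒square {a} χa with x , x²≡a ← isQR⇒square a p χa = x , mk≈ x²≡a

  χ-1 : χ 1 ≡ true
  χ-1 = χ-square 1

  χ-false⇒Unit : ∀ {a} → χ a ≡ false → Unit a
  χ-false⇒Unit χa p∣a = contradiction (trans (sym χa) (trans (χ-resp-≈ (∣⇒≈0 p∣a)) (χ-square 0))) λ ()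

  χ-*-residues : ∀ {a b} → χ a ≡ true → χ b ≡ true → χ (a * b) ≡ true
  χ-*-residues χa χb with x , x²≈a ← χ⇒square χa | y , y²≈b ← χ⇒square χb =
    square≈⇒χ (x * y) (≈-trans (≡⇒≈ (*-CS.interchange x y x y)) (*-cong x²≈a y²≈b))

  χ-residue-cancelˡ : ∀ {a b} → Unit a → χ a ≡ true → χ (a * b) ≡ true → χ b ≡ true
  χ-residue-cancelˡ {a} {b} ua χa χab
    with x , x²≈a ← χ⇒square χa | y , y²≈ab ← χ⇒square χab
    with x⁻¹ , xx⁻¹≈1 ← inverse {x} (λ p∣x → Unit-resp-≈ (≈-sym x²≈a) ua (∣n⇒∣m*n x p∣x))
    = square≈⇒χ (x⁻¹ * y) (begin
      x⁻¹ * y * (x⁻¹ * y)        ≡⟨ *-CS.interchange x⁻¹ y x⁻¹ y ⟩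
      x⁻¹ * x⁻¹ * (y * y)        ≈⟨ *-congˡ (x⁻¹ * x⁻¹) (≈-trans y²≈ab (*-congʳ b (≈-sym x²≈a))) ⟩
      x⁻¹ * x⁻¹ * (x * x * b)    ≡⟨ regroup x x⁻¹ b ⟩
      x * x⁻¹ * (x * x⁻¹) * b    ≈⟨ *-congʳ b (*-cong xx⁻¹≈1 xx⁻¹≈1) ⟩
      1 * 1 * b                  ≡⟨ *-identityˡ b ⟩
      b                          ∎)
    where
    open ≈-Reasoning
    regroup : ∀ x y b → y * y * (x * x * b) ≡ x * y * (x * y) * b
    regroup = solve-∀

-- Multiplicativity of the quadratic character

Unique⇒length≤ : ∀ {xs ys : List A} → Unique xs → (∀ {x} → x ∈ xs → x ∈ ys) → length xs ≤ length ys
Unique⇒length≤ {xs = []}     _              _     = z≤n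
Unique⇒length≤ {xs = x ∷ xs} (x∉xs ∷ uxs) xs⊆ys with pre , post , refl ← ∈-∃++ (xs⊆ys (here refl)) = begin
  suc (length xs)              ≤⟨ s≤s (Unique⇒length≤ uxs xs⊆pre++post) ⟩
  suc (length (pre ++ post))   ≡⟨ length-++-∷ ⟨
  length (pre ++ x ∷ post)     ∎
  where
  open ≤-Reasoning
  length-++-∷ : length (pre ++ x ∷ post) ≡ suc (length (pre ++ post))
  length-++-∷ = trans (length-++ pre) (trans (+-suc _ _) (cong suc (sym (length-++ pre))))
  xs⊆pre++post : ∀ {y} → y ∈ xs → y ∈ pre ++ post
  xs⊆pre++post {y} y∈xs with ∈-++⁻ pre (xs⊆ys (there y∈xs))
  ... | inj₁ y∈pre         = ∈-++⁺ˡ y∈pre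
  ... | inj₂ (here refl)   = ⊥-elim (All.lookup x∉xs y∈xs refl)
  ... | inj₂ (there y∈post) = ∈-++⁺ʳ pre y∈post

Unique-map⁺ : ∀ (f : A → B) {xs} → (∀ {x y} → x ∈ xs → y ∈ xs → f x ≡ f y → x ≡ y) → Unique xs → Unique (map f xs)
Unique-map⁺ f {[]}     _   []           = []
Unique-map⁺ f {x ∷ xs} inj (x∉xs ∷ uxs) =
  All.tabulate fx∉ ∷ Unique-map⁺ f (λ x∈ y∈ → inj (there x∈) (there y∈)) uxs
  where
  fx∉ : ∀ {z} → z ∈ map f xs → f x ≢ z
  fx∉ z∈ fx≡z with y , y∈xs , refl ← ∈-map⁻ f z∈ = All.lookup x∉xs y∈xs (inj (here refl) (there y∈xs) fx≡z)

length-filterᵇ-split : ∀ (f : A → Bool) xs → length (filterᵇ f xs) + length (filterᵇ (not ∘ f) xs) ≡ length xs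
length-filterᵇ-split f []       = refl
length-filterᵇ-split f (x ∷ xs) with f x
... | true  = cong suc (length-filterᵇ-split f xs)
... | false = trans (+-suc _ _) (cong suc (length-filterᵇ-split f xs))

0<length⇒∃∈ : ∀ (xs : List A) → 0 < length xs → ∃ (_∈ xs)
0<length⇒∃∈ (x ∷ _) _ = x , here refl

∈-filterᵇ⁺ : ∀ (f : A → Bool) {x xs} → x ∈ xs → f x ≡ true → x ∈ filterᵇ f xs
∈-filterᵇ⁺ f x∈xs fx = ∈-filter⁺ (T? ∘ f) x∈xs (Equivalence.from T-≡ fx)

∈-filterᵇ⁻ : ∀ (f : A → Bool) {x xs} → x ∈ filterᵇ f xs → x ∈ xs × f x ≡ true
∈-filterᵇ⁻ f x∈ with x∈xs , fx ← ∈-filter⁻ (T? ∘ f) x∈ = x∈xs , Equivalence.to T-≡ fx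

infix 4 _⇔ᵇ_
_⇔ᵇ_ : Bool → Bool → Bool
true  ⇔ᵇ b = b
false ⇔ᵇ b = not b

⇔ᵇ-true : ∀ x y → (x ⇔ᵇ y) ≡ true → y ≡ x
⇔ᵇ-true true  true  _ = refl
⇔ᵇ-true false false _ = refl

⇔ᵇ-cancelˡ : ∀ x s → (x ⇔ᵇ (x ⇔ᵇ s)) ≡ s
⇔ᵇ-cancelˡ true  s     = refl
⇔ᵇ-cancelˡ false true  = refl
⇔ᵇ-cancelˡ false false = refl

⇔ᵇ-cancelʳ : ∀ s x → ((s ⇔ᵇ x) ⇔ᵇ x) ≡ s
⇔ᵇ-cancelʳ true  true  = refl
⇔ᵇ-cancelʳ true  false = refl
⇔ᵇ-cancelʳ false true  = refl
⇔ᵇ-cancelʳ false false = refl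

module OddPrime {p : ℕ} (prime : Prime p) (p≢2 : p ≢ 2) where

  open PrimeModulus prime public

  half : ℕ
  half = p / 2

  p%2≡1 : p % 2 ≡ 1
  p%2≡1 with p % 2 | m%n<n p 2 | m%n≡0⇒n∣m p 2
  ... | 0 | _ | 2∣p with prime⇒irreducible prime (2∣p refl)
  ...   | inj₁ ()
  ...   | inj₂ 2≡p = ⊥-elim (p≢2 (sym 2≡p))
  p%2≡1 | 1 | _ | _ = refl
  p%2≡1 | suc (suc _) | s≤s (s≤s ()) | _

  p≡1+2half : p ≡ suc (half + half)
  p≡1+2half = begin
    p                  ≡⟨ m≡m%n+[m/n]*n p 2 ⟩
    p % 2 + half * 2   ≡⟨ cong (_+ half * 2) p%2≡1 ⟩
    suc (half * 2)     ≡⟨ cong suc (*-comm half 2) ⟩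
    suc (2 * half)     ≡⟨ cong (λ h → suc (half + h)) (+-identityʳ half) ⟩
    suc (half + half)  ∎
    where open ≡-Reasoning

  0<half : 0 < half
  0<half with half | p≡1+2half
  ... | zero  | p≡1 = ⊥-elim (<⇒≢ 1<p (sym p≡1))
  ... | suc _ | _   = s≤s z≤n

  nonzeroResidues : List ℕ
  nonzeroResidues = applyUpTo suc (half + half)

  ∈-nonzeroResidues⁻ : ∀ {x} → x ∈ nonzeroResidues → 0 < x × x < p
  ∈-nonzeroResidues⁻ x∈ with i , i<2half , refl ← ∈-applyUpTo⁻ suc x∈ = s≤s z≤n , subst (suc i <_) (sym p≡1+2half) (s≤s i<2half)

  ∈-nonzeroResidues⁺ : ∀ {x} → 0 < x → x < p → x ∈ nonzeroResidues
  ∈-nonzeroResidues⁺ {suc i} _ x<p = ∈-applyUpTo⁺ suc (≤-pred (subst (suc i <_) p≡1+2half x<p))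

  Unit⇒%∈nonzeroResidues : ∀ {a} → Unit a → a % p ∈ nonzeroResidues
  Unit⇒%∈nonzeroResidues {a} ua = ∈-nonzeroResidues⁺ (n≢0⇒n>0 (Unit⇒%≢0 ua)) (m%n<n a p)

  residues nonresidues : List ℕ
  residues    = filterᵇ χ nonzeroResidues
  nonresidues = filterᵇ (not ∘ χ) nonzeroResidues

  ∈-residues⁻ : ∀ {r} → r ∈ residues → Unit r × χ r ≡ true × r < p
  ∈-residues⁻ r∈ with r∈nz , χr ← ∈-filterᵇ⁻ χ r∈ with 0<r , r<p ← ∈-nonzeroResidues⁻ r∈nz = 0<x<p⇒Unit 0<r r<p , χr , r<p

  ∈-nonresidues⁺ : ∀ {a} → Unit a → χ a ≡ false → a % p ∈ nonresidues
  ∈-nonresidues⁺ {a} ua χa = ∈-filterᵇ⁺ (not ∘ χ) (Unit⇒%∈nonzeroResidues ua) (cong not (trans (χ-resp-≈ (mod-≈ a)) χa))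

  ∈-nonresidues⁻ : ∀ {g} → g ∈ nonresidues → Unit g × χ g ≡ false
  ∈-nonresidues⁻ g∈ with g∈nz , ¬χg ← ∈-filterᵇ⁻ (not ∘ χ) g∈ with 0<g , g<p ← ∈-nonzeroResidues⁻ g∈nz =
    0<x<p⇒Unit 0<g g<p , not-injective ¬χg

  lowerHalf : List ℕ
  lowerHalf = applyUpTo suc half

  ∈-lowerHalf⁻ : ∀ {x} → x ∈ lowerHalf → 0 < x × x ≤ half
  ∈-lowerHalf⁻ x∈ with i , i<half , refl ← ∈-applyUpTo⁻ suc x∈ = s≤s z≤n , i<half

  ∈-lowerHalf⁺ : ∀ {x} → 0 < x → x ≤ half → x ∈ lowerHalf
  ∈-lowerHalf⁺ {suc i} _ x≤half = ∈-applyUpTo⁺ suc x≤half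

  ≤half⇒<p : ∀ {x} → x ≤ half → x < p
  ≤half⇒<p {x} x≤half = subst (x <_) (sym p≡1+2half) (s≤s (≤-trans x≤half (m≤m+n half half)))

  p∸x≤half : ∀ {x} → half < x → p ∸ x ≤ half
  p∸x≤half {x} half<x = begin
    p ∸ x                        ≤⟨ ∸-monoʳ-≤ p half<x ⟩
    p ∸ suc half                 ≡⟨ cong (_∸ suc half) p≡1+2half ⟩
    suc (half + half) ∸ suc half ≡⟨ m+n∸m≡n half half ⟩
    half                         ∎
    where open ≤-Reasoning

  [p∸x]²≈x² : ∀ {x} → x ≤ p → (p ∸ x) * (p ∸ x) ≈ x * x
  [p∸x]²≈x² {x} x≤p = begin
    y * y                ≈⟨ m+kp≈m (y * y) x ⟨
    y * y + x * p        ≡⟨ cong (λ q → y * y + x * q) y+x≡p ⟨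
    y * y + x * (y + x)  ≡⟨ expand y x ⟩
    x * x + y * (y + x)  ≡⟨ cong (λ q → x * x + y * q) y+x≡p ⟩
    x * x + y * p        ≈⟨ m+kp≈m (x * x) y ⟩
    x * x                ∎
    where
    open ≈-Reasoning
    y : ℕ
    y = p ∸ x
    y+x≡p : y + x ≡ p
    y+x≡p = m∸n+n≡m x≤p
    expand : ∀ y x → y * y + x * (y + x) ≡ x * x + y * (y + x)
    expand = solve-∀

  square : ℕ → ℕ
  square x = (x * x) % p

  squares : List ℕ
  squares = map square lowerHalf

  square-injective-≤ : ∀ {x y} → 0 < x → y ≤ half → x ≤ y → x * x ≈ y * y → x ≡ y
  square-injective-≤ {x} {y} 0<x y≤half x≤y x²≈y²
    with euclidsLemma d (x + y) prime (≈0⇒∣ (≈-sym (+-cancelˡ-≈ x²+0≈x²+d[x+y])))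
    where
    d : ℕ
    d = y ∸ x
    x+d≡y : x + d ≡ y
    x+d≡y = m+[n∸m]≡n x≤y
    expand : ∀ x d → (x + d) * (x + d) ≡ x * x + d * (x + (x + d))
    expand = solve-∀
    x²+0≈x²+d[x+y] : x * x + 0 ≈ x * x + d * (x + y)
    x²+0≈x²+d[x+y] = begin
      x * x + 0               ≡⟨ +-identityʳ (x * x) ⟩
      x * x                   ≈⟨ x²≈y² ⟩
      y * y                   ≡⟨ cong (λ z → z * z) x+d≡y ⟨
      (x + d) * (x + d)       ≡⟨ expand x d ⟩
      x * x + d * (x + (x + d)) ≡⟨ cong (λ z → x * x + d * (x + z)) x+d≡y ⟩
      x * x + d * (x + y)     ∎
      where open ≈-Reasoning
  ... | inj₁ p∣d = trans (sym (+-identityʳ x)) (trans (cong (x +_) (sym (∣∧<⇒≡0 p∣d d<p))) (m+[n∸m]≡n x≤y))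
    where
    d<p : y ∸ x < p
    d<p = ≤-<-trans (m∸n≤m y x) (≤half⇒<p y≤half)
  ... | inj₂ p∣x+y = ⊥-elim (>⇒≢ (≤-trans 0<x (m≤m+n x y)) (∣∧<⇒≡0 p∣x+y x+y<p))
    where
    x+y<p : x + y < p
    x+y<p = subst (x + y <_) (sym p≡1+2half) (s≤s (+-mono-≤ (≤-trans x≤y y≤half) y≤half))

  square-injective : ∀ {x y} → x ∈ lowerHalf → y ∈ lowerHalf → square x ≡ square y → x ≡ y
  square-injective {x} {y} x∈ y∈ x²≡y² with ∈-lowerHalf⁻ x∈ | ∈-lowerHalf⁻ y∈ | ≤-total x y
  ... | 0<x , _      | _ , y≤half | inj₁ x≤y = square-injective-≤ 0<x y≤half x≤y (mk≈ x²≡y²)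
  ... | _ , x≤half   | 0<y , _    | inj₂ y≤x = sym (square-injective-≤ 0<y x≤half y≤x (mk≈ (sym x²≡y²)))

  squares⊆residues : ∀ {z} → z ∈ squares → z ∈ residues
  squares⊆residues z∈ with x , x∈ , refl ← ∈-map⁻ square z∈ with 0<x , x≤half ← ∈-lowerHalf⁻ x∈ =
    ∈-filterᵇ⁺ χ (Unit⇒%∈nonzeroResidues (*-Unit ux ux)) (trans (χ-resp-≈ (mod-≈ (x * x))) (χ-square x))
    where
    ux : Unit x
    ux = 0<x<p⇒Unit 0<x (≤half⇒<p x≤half)

  square≈⇒∈squares : ∀ {r} y → r < p → 0 < y → y ≤ half → y * y ≈ r → r ∈ squares
  square≈⇒∈squares {r} y r<p 0<y y≤half (mk≈ y²≡r) =
    subst (_∈ squares) (trans y²≡r (m<n⇒m%n≡m r<p)) (∈-map⁺ square (∈-lowerHalf⁺ 0<y y≤half))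

  residues⊆squares : ∀ {r} → r ∈ residues → r ∈ squares
  residues⊆squares {r} r∈ with ur , χr , r<p ← ∈-residues⁻ r∈ with x , x²≈r ← χ⇒square χr with x % p ≤? half
  ... | yes x′≤half = square≈⇒∈squares x′ r<p 0<x′ x′≤half x′²≈r
    where
    x′ : ℕ
    x′ = x % p
    x′²≈r : x′ * x′ ≈ r
    x′²≈r = ≈-trans (*-cong (mod-≈ x) (mod-≈ x)) x²≈r
    0<x′ : 0 < x′
    0<x′ = n≢0⇒n>0 (λ x′≡0 → ur (≈0⇒∣ (≈-trans (≈-sym x′²≈r) (≡⇒≈ (cong (λ z → z * z) x′≡0)))))
  ... | no x′≰half = square≈⇒∈squares (p ∸ x′) r<p (m<n⇒0<n∸m x′<p) (p∸x≤half (≰⇒> x′≰half)) y²≈r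
    where
    x′ : ℕ
    x′ = x % p
    x′<p : x′ < p
    x′<p = m%n<n x p
    y²≈r : (p ∸ x′) * (p ∸ x′) ≈ r
    y²≈r = ≈-trans ([p∸x]²≈x² (<⇒≤ x′<p)) (≈-trans (*-cong (mod-≈ x) (mod-≈ x)) x²≈r)

  length-squares : length squares ≡ half
  length-squares = trans (length-map square lowerHalf) (length-applyUpTo suc half)

  Unique-applyUpTo-suc : ∀ n → Unique (applyUpTo suc n)
  Unique-applyUpTo-suc n = Unique.applyUpTo⁺₁ suc n (λ i<j _ → <⇒≢ (s≤s i<j))

  length-residues : length residues ≡ half
  length-residues = ≤-antisym
    (subst (length residues ≤_) length-squares
      (Unique⇒length≤ (Unique.filter⁺ (T? ∘ χ) (Unique-applyUpTo-suc (half + half))) residues⊆squares))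
    (subst (_≤ length residues) length-squares
      (Unique⇒length≤ (Unique-map⁺ square square-injective (Unique-applyUpTo-suc half)) squares⊆residues))

  length-nonresidues : length nonresidues ≡ half
  length-nonresidues = +-cancelˡ-≡ half _ _ (begin
    half + length nonresidues             ≡⟨ cong (_+ length nonresidues) length-residues ⟨
    length residues + length nonresidues  ≡⟨ length-filterᵇ-split χ nonzeroResidues ⟩
    length nonzeroResidues                ≡⟨ length-applyUpTo suc (half + half) ⟩
    half + half                           ∎)
    where open ≡-Reasoning

  -- Otherwise ab together with the a·r for the half residues r would be half + 1 distinct nonresidues.
  χ-*-nonresidues : ∀ {a b} → χ a ≡ false → χ b ≡ false → χ (a * b) ≡ true
  χ-*-nonresidues {a} {b} χa χb with χ (a * b) in χab
  ... | true  = refl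
  ... | false = ⊥-elim (<-irrefl refl (begin-strict
    half                          ≡⟨ length-residues ⟨
    length residues               ≡⟨ length-map a* residues ⟨
    length (map a* residues)      <⟨ Unique⇒length≤ (All.tabulate ab∉ ∷ Unique-map⁺ a* a*-injective uniqueResidues) ⊆nonresidues ⟩
    length nonresidues            ≡⟨ length-nonresidues ⟩
    half                          ∎))
    where
    open ≤-Reasoning
    ua : Unit a
    ua = χ-false⇒Unit χa
    a* : ℕ → ℕ
    a* r = (a * r) % p
    uniqueResidues : Unique residues
    uniqueResidues = Unique.filter⁺ (T? ∘ χ) (Unique-applyUpTo-suc (half + half))
    a*-injective : ∀ {r r′} → r ∈ residues → r′ ∈ residues → a* r ≡ a* r′ → r ≡ r′
    a*-injective r∈ r′∈ ar≡ar′ = <p∧≈⇒≡ (proj₂ (proj₂ (∈-residues⁻ r∈))) (proj₂ (proj₂ (∈-residues⁻ r′∈))) (*-cancelˡ-≈ ua (mk≈ ar≡ar′))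
    ab∉ : ∀ {z} → z ∈ map a* residues → a* b ≢ z
    ab∉ z∈ ab≡ar with r , r∈ , refl ← ∈-map⁻ a* z∈ with _ , χr , _ ← ∈-residues⁻ r∈ =
      contradiction (trans (sym χb) (trans (χ-resp-≈ (*-cancelˡ-≈ {a} {b} {r} ua (mk≈ ab≡ar))) χr)) λ ()
    ⊆nonresidues : ∀ {z} → z ∈ a* b ∷ map a* residues → z ∈ nonresidues
    ⊆nonresidues (here refl) = ∈-nonresidues⁺ (*-Unit ua (χ-false⇒Unit χb)) χab
    ⊆nonresidues (there z∈) with r , r∈ , refl ← ∈-map⁻ a* z∈ with ur , χr , _ ← ∈-residues⁻ r∈ =
      ∈-nonresidues⁺ (*-Unit ua ur) χar
      where
      χar : χ (a * r) ≡ false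
      χar with χ (a * r) in χar
      ... | false = refl
      ... | true  = contradiction (trans (sym χa) (χ-residue-cancelˡ ur χr (trans (cong χ (*-comm r a)) χar))) λ ()

  χ-* : ∀ {a b} → Unit a → Unit b → χ (a * b) ≡ (χ a ⇔ᵇ χ b)
  χ-* {a} {b} ua ub with χ a in χa | χ b in χb
  ... | true  | true  = χ-*-residues χa χb
  ... | false | false = χ-*-nonresidues χa χb
  ... | true  | false with χ (a * b) in χab
  ...   | false = refl
  ...   | true  = contradiction (trans (sym χb) (χ-residue-cancelˡ ua χa χab)) λ ()
  χ-* {a} {b} ua ub | false | true with χ (a * b) in χab
  ...   | false = refl
  ...   | true  = contradiction (trans (sym χa) (χ-residue-cancelˡ ub χb (trans (cong χ (*-comm b a)) χab))) λ ()

  nonresidue : ∃ λ g → Unit g × χ g ≡ false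
  nonresidue with g , g∈ ← 0<length⇒∃∈ nonresidues (subst (0 <_) (sym length-nonresidues) 0<half) = g , ∈-nonresidues⁻ g∈

-- Unit weights with prescribed quadratic characters modulo a prime p ≥ 7

switchPoint : ∀ (f : ℕ → Bool) m → 0 < m → f 1 ≡ true → f m ≡ false → ∃ λ c → 0 < c × c < m × f c ≡ true × f (suc c) ≡ false
switchPoint f (suc m) _ f1 f[1+m] = go m f[1+m]
  where
  go : ∀ m → f (suc m) ≡ false → ∃ λ c → 0 < c × c < suc m × f c ≡ true × f (suc c) ≡ false
  go zero    f1′ = contradiction (trans (sym f1) f1′) λ ()
  go (suc m) f[2+m] with f (suc m) in f[1+m]
  ... | true  = suc m , s≤s z≤n , ≤-refl , f[1+m] , f[2+m]
  ... | false with go m f[1+m]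
  ...   | c , 0<c , c<1+m , fc , f[1+c] = c , 0<c , m<n⇒m<1+n c<1+m , fc , f[1+c]

prime-7≤q≤10⇒q≡7 : ∀ {q} → Prime q → 7 ≤ q → q ≤ 10 → q ≡ 7
prime-7≤q≤10⇒q≡7 {q} pq 7≤q q≤10 = go (q ∸ 7) (m+[n∸m]≡n 7≤q) (∸-monoˡ-≤ 7 q≤10)
  where
  go : ∀ k → 7 + k ≡ q → k ≤ 3 → q ≡ 7
  go 0 7≡q _ = sym 7≡q
  go 1 refl _ = ⊥-elim (prime⇒¬composite pq (composite {2} (s≤s (s≤s (s≤s z≤n))) (divides 4 refl)))
  go 2 refl _ = ⊥-elim (prime⇒¬composite pq (composite {3} (s≤s (s≤s (s≤s (s≤s z≤n)))) (divides 3 refl)))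
  go 3 refl _ = ⊥-elim (prime⇒¬composite pq (composite {2} (s≤s (s≤s (s≤s z≤n))) (divides 5 refl)))
  go (suc (suc (suc (suc _)))) _ (s≤s (s≤s (s≤s ())))

infix 7 _·_
_·_ : ∀ {m} → (Fin m → ℕ) → (Fin m → ℕ) → ℕ
w · t = ∑ (λ j → w j * t j)

infixl 6 _[_]≔_
_[_]≔_ : ∀ {m} → (Fin m → ℕ) → Fin m → ℕ → Fin m → ℕ
w [ a ]≔ x = updateAt w a (const x)

·-[]≔ : ∀ {m} (w t : Fin m → ℕ) a x → (w [ a ]≔ x) · t + w a * t a ≡ w · t + x * t a
·-[]≔ w t zero    x = +-CS.xy∙z≈zy∙x (x * t zero) (tail w · tail t) (w zero * t zero)
·-[]≔ w t (suc a) x = begin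
  w zero * t zero + (tail w [ a ]≔ x) · tail t + w (suc a) * t (suc a)   ≡⟨ +-assoc (w zero * t zero) _ _ ⟩
  w zero * t zero + ((tail w [ a ]≔ x) · tail t + w (suc a) * t (suc a)) ≡⟨ cong (w zero * t zero +_) (·-[]≔ (tail w) (tail t) a x) ⟩
  w zero * t zero + (tail w · tail t + x * t (suc a))                    ≡⟨ +-assoc (w zero * t zero) _ _ ⟨
  w · t + x * t (suc a)                                                  ∎
  where open ≡-Reasoning

·-[]≔₂ : ∀ {m} (w t : Fin m → ℕ) {a b} → a ≢ b → ∀ x y →
  (w [ a ]≔ x [ b ]≔ y) · t + (w a * t a + w b * t b) ≡ w · t + (x * t a + y * t b)
·-[]≔₂ {m} w t {a} {b} a≢b x y = begin
  W · t + (w a * t a + w b * t b)    ≡⟨ +-CS.x∙yz≈xz∙y (W · t) _ _ ⟩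
  W · t + w b * t b + w a * t a      ≡⟨ cong (λ z → W · t + z * t b + w a * t a) (updateAt-minimal b a w (a≢b ∘ sym)) ⟨
  W · t + w′ b * t b + w a * t a     ≡⟨ cong (_+ w a * t a) (·-[]≔ w′ t b y) ⟩
  w′ · t + y * t b + w a * t a       ≡⟨ +-CS.xy∙z≈xz∙y (w′ · t) _ _ ⟩
  w′ · t + w a * t a + y * t b       ≡⟨ cong (_+ y * t b) (·-[]≔ w t a x) ⟩
  w · t + x * t a + y * t b          ≡⟨ +-assoc (w · t) _ _ ⟩
  w · t + (x * t a + y * t b)        ∎
  where
  open ≡-Reasoning
  w′ W : Fin m → ℕ
  w′ = w [ a ]≔ x
  W  = w′ [ b ]≔ y

module _ {m} (w : Fin m → ℕ) {a b : Fin m} {x y : ℕ} where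

  []≔₂-at₂ : (w [ a ]≔ x [ b ]≔ y) b ≡ y
  []≔₂-at₂ = updateAt-updates b (w [ a ]≔ x)

  []≔₂-at₁ : a ≢ b → (w [ a ]≔ x [ b ]≔ y) a ≡ x
  []≔₂-at₁ a≢b = trans (updateAt-minimal a b (w [ a ]≔ x) a≢b) (updateAt-updates a w)

  []≔₂-elsewhere : ∀ {j} → j ≢ a → j ≢ b → (w [ a ]≔ x [ b ]≔ y) j ≡ w j
  []≔₂-elsewhere {j} j≢a j≢b = trans (updateAt-minimal j b (w [ a ]≔ x) j≢b) (updateAt-minimal j a w j≢a)

  []≔₂-elim : (P : Fin m → ℕ → Set) → P a x → P b y → (∀ j → j ≢ a → j ≢ b → P j (w j)) →
    ∀ j → P j ((w [ a ]≔ x [ b ]≔ y) j)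
  []≔₂-elim P Pa Pb Pj j with j Fin.≟ b | j Fin.≟ a
  ... | yes refl | _        = subst (P j) (sym []≔₂-at₂) Pb
  ... | no j≢b   | yes refl = subst (P j) (sym ([]≔₂-at₁ j≢b)) Pa
  ... | no j≢b   | no j≢a   = subst (P j) (sym ([]≔₂-elsewhere j≢a j≢b)) (Pj j j≢a j≢b)

module PrimeAtLeast7 {p : ℕ} (prime : Prime p) (7≤p : 7 ≤ p) where

  open OddPrime prime (λ p≡2 → <⇒≱ (subst (7 ≤_) p≡2 7≤p) (s≤s (s≤s z≤n))) public

  n<p : ∀ n {n<7 : True (n <? 7)} → n < p
  n<p n {n<7} = <-≤-trans (toWitness n<7) 7≤p

  Split : ℕ → Bool → Bool → Set
  Split c s t = ∃₂ λ u v → Unit u × Unit v × u + v ≈ c × χ u ≡ s × χ v ≡ t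

  Split-swap : ∀ {c s t} → Split c s t → Split c t s
  Split-swap (u , v , uu , uv , u+v≈c , χu , χv) = v , u , uv , uu , ≈-trans (≡⇒≈ (+-comm v u)) u+v≈c , χv , χu

  χ-inverse : ∀ {a b} → Unit a → a * b ≈ 1 → χ b ≡ χ a
  χ-inverse {a} {b} ua ab≈1 = ⇔ᵇ-true (χ a) (χ b) (trans (sym (χ-* ua (inverse⇒Unit {a} ab≈1))) (trans (χ-resp-≈ ab≈1) χ-1))

  -- 1 = i + c·i with i the inverse of c + 1.
  consecutive⇒Split₁ : ∀ c → 0 < c → suc c < p → Split 1 (χ (suc c)) (χ c ⇔ᵇ χ (suc c))
  consecutive⇒Split₁ c 0<c 1+c<p = i , c * i , ui , *-Unit uc ui , [1+c]i≈1 ,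
    χ-inverse u[1+c] [1+c]i≈1 , trans (χ-* uc ui) (cong (χ c ⇔ᵇ_) (χ-inverse u[1+c] [1+c]i≈1))
    where
    uc : Unit c
    uc = 0<x<p⇒Unit 0<c (<-trans (n<1+n c) 1+c<p)
    u[1+c] : Unit (suc c)
    u[1+c] = 0<x<p⇒Unit (s≤s z≤n) 1+c<p
    i : ℕ
    i = proj₁ (inverse u[1+c])
    [1+c]i≈1 : suc c * i ≈ 1
    [1+c]i≈1 = proj₂ (inverse u[1+c])
    ui : Unit i
    ui = inverse⇒Unit {suc c} [1+c]i≈1

  -- One of 2, 5 and 10 = 2·5 is a residue; and 10 < p unless p = 7, where 2 ≡ 3².
  Split₁-residues : Split 1 true true
  Split₁-residues with χ 2 in χ2
  ... | true = subst₂ (Split 1) χ2 (trans (cong (χ 1 ⇔ᵇ_) χ2) (cong (_⇔ᵇ true) χ-1)) (consecutive⇒Split₁ 1 (s≤s z≤n) (n<p 2))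
  ... | false with χ 5 in χ5
  ...   | true = subst₂ (Split 1) χ5 (trans (cong (χ 4 ⇔ᵇ_) χ5) (cong (_⇔ᵇ true) (χ-square 2))) (consecutive⇒Split₁ 4 (s≤s z≤n) (n<p 5))
  ...   | false = subst₂ (Split 1) χ10 (trans (cong (χ 9 ⇔ᵇ_) χ10) (cong (_⇔ᵇ true) (χ-square 3))) (consecutive⇒Split₁ 9 (s≤s z≤n) 10<p)
    where
    χ10 : χ 10 ≡ true
    χ10 = χ-*-nonresidues {2} {5} χ2 χ5
    10<p : 10 < p
    10<p with 10 <? p
    ... | yes 10<p = 10<p
    ... | no 10≮p with refl ← prime-7≤q≤10⇒q≡7 prime 7≤p (≮⇒≥ 10≮p) = contradiction (trans (sym χ2) (square≈⇒χ {2} 3 (mk≈ refl))) λ ()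

  NonresidueBelow : ℕ → Set
  NonresidueBelow m = ∃ λ g → 0 < g × g < m × χ g ≡ false

  nonresidue<p : NonresidueBelow p
  nonresidue<p = let g , ug , χg = nonresidue in
    g % p , n≢0⇒n>0 (Unit⇒%≢0 ug) , m%n<n g p , trans (χ-resp-≈ (mod-≈ g)) χg

  Split₁-nonresidues : Split 1 false false
  Split₁-nonresidues =
    let g , 0<g , g<p , χg = nonresidue<p
        c , 0<c , c<g , χc , χ[1+c] = switchPoint χ g 0<g χ-1 χg
    in subst₂ (Split 1) χ[1+c] (cong₂ _⇔ᵇ_ χc χ[1+c]) (consecutive⇒Split₁ c 0<c (≤-<-trans c<g g<p))

  nonresidue-below-p-1 : ∃ λ c → 0 < c × suc c < p × χ c ≡ false
  nonresidue-below-p-1 = lower nonresidue<p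
    where
    lower : NonresidueBelow p → ∃ λ c → 0 < c × suc c < p × χ c ≡ false
    lower (g , 0<g , g<p , χg) with suc g <? p
    ... | yes 1+g<p = g , 0<g , 1+g<p , χg
    ... | no 1+g≮p with χ 2 in χ2
    ...   | false = 2 , s≤s z≤n , n<p 3 , χ2
    ...   | true  = g ∸ 1 , m<n⇒0<n∸m 1<g , subst (_< p) (sym (m+[n∸m]≡n 0<g)) g<p , χ[g∸1]
      where
      1+g≡p : suc g ≡ p
      1+g≡p = ≤-antisym g<p (≮⇒≥ 1+g≮p)
      1<g : 1 < g
      1<g = ≤-pred (subst (2 <_) (sym 1+g≡p) (n<p 2))
      2g≡g∸1+p : g * 2 ≡ g ∸ 1 + 1 * p
      2g≡g∸1+p = trans (double g 1<g) (cong (λ q → g ∸ 1 + 1 * q) 1+g≡p)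
        where
        double : ∀ g → 1 < g → g * 2 ≡ g ∸ 1 + 1 * suc g
        double (suc h) _ = identity h
          where
          identity : ∀ h → suc h * 2 ≡ h + 1 * suc (suc h)
          identity = solve-∀
      χ[g∸1] : χ (g ∸ 1) ≡ false
      χ[g∸1] = begin
        χ (g ∸ 1)        ≡⟨ χ-resp-≈ (≈-trans (≡⇒≈ 2g≡g∸1+p) (m+kp≈m (g ∸ 1) 1)) ⟨
        χ (g * 2)        ≡⟨ χ-* (0<x<p⇒Unit 0<g g<p) (0<x<p⇒Unit (s≤s z≤n) (n<p 2)) ⟩
        (χ g ⇔ᵇ χ 2)     ≡⟨ cong₂ _⇔ᵇ_ χg χ2 ⟩
        false            ∎
        where open ≡-Reasoning

  Split₁-not : ∀ x s → Split 1 x (not x) → Split 1 s (not s)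
  Split₁-not true  true  sp = sp
  Split₁-not false false sp = sp
  Split₁-not true  false sp = Split-swap sp
  Split₁-not false true  sp = Split-swap sp

  Split₁-mixed : ∀ s → Split 1 s (not s)
  Split₁-mixed s = let c , 0<c , 1+c<p , χc = nonresidue-below-p-1 in
    Split₁-not (χ (suc c)) s (subst (λ b → Split 1 (χ (suc c)) (b ⇔ᵇ χ (suc c))) χc (consecutive⇒Split₁ c 0<c 1+c<p))

  Split₁ : ∀ s t → Split 1 s t
  Split₁ true  true  = Split₁-residues
  Split₁ false false = Split₁-nonresidues
  Split₁ true  false = Split₁-mixed true
  Split₁ false true  = Split₁-mixed false

  split : ∀ {c} → Unit c → ∀ s t → Split c s t
  split {c} uc s t = scale (Split₁ (χ c ⇔ᵇ s) (χ c ⇔ᵇ t))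
    where
    scale : Split 1 (χ c ⇔ᵇ s) (χ c ⇔ᵇ t) → Split c s t
    scale (u , v , uu , uv , u+v≈1 , χu , χv) = c * u , c * v , *-Unit uc uu , *-Unit uc uv , (begin
      c * u + c * v  ≡⟨ *-distribˡ-+ c u v ⟨
      c * (u + v)    ≈⟨ *-congˡ c u+v≈1 ⟩
      c * 1          ≡⟨ *-identityʳ c ⟩
      c              ∎) ,
      trans (χ-* uc uu) (trans (cong (χ c ⇔ᵇ_) χu) (⇔ᵇ-cancelˡ (χ c) s)) ,
      trans (χ-* uc uv) (trans (cong (χ c ⇔ᵇ_) χv) (⇔ᵇ-cancelˡ (χ c) t))
      where open ≈-Reasoning

  representative : Bool → ℕ
  representative true  = 1
  representative false = proj₁ nonresidue

  HasCharacters : ∀ {m} → (Fin m → ℕ) → (Fin m → Bool) → Set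
  HasCharacters w e = ∀ j → Unit (w j) × χ (w j) ≡ e j

  representatives-HasCharacters : ∀ {m} (e : Fin m → Bool) → HasCharacters (representative ∘ e) e
  representatives-HasCharacters e j with e j
  ... | true  = Unit-1 , χ-1
  ... | false = proj₂ nonresidue

  PrescribedZeroSum : ∀ {m} → (Fin m → ℕ) → (Fin m → Bool) → Set
  PrescribedZeroSum t e = ∃ λ w → HasCharacters w e × w · t ≈ 0

  divideBy : ∀ {t} → Unit t → ∀ {u} → Unit u → ∃ λ w → (Unit w × χ w ≡ (χ u ⇔ᵇ χ t)) × w * t ≈ u
  divideBy {t} ut {u} uu = u * i , (*-Unit uu ui , trans (χ-* uu ui) (cong (χ u ⇔ᵇ_) (χ-inverse ut ti≈1))) , (begin
    u * i * t    ≡⟨ *-CS.xy∙z≈x∙zy u i t ⟩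
    u * (t * i)  ≈⟨ *-congˡ u ti≈1 ⟩
    u * 1        ≡⟨ *-identityʳ u ⟩
    u            ∎)
    where
    open ≈-Reasoning
    i : ℕ
    i = proj₁ (inverse ut)
    ti≈1 : t * i ≈ 1
    ti≈1 = proj₂ (inverse ut)
    ui : Unit i
    ui = inverse⇒Unit {t} ti≈1

  WeightedSplit : ℕ → ℕ → ℕ → Bool → Bool → Set
  WeightedSplit t₁ t₂ c e₁ e₂ = ∃₂ λ w₁ w₂ → (Unit w₁ × χ w₁ ≡ e₁) × (Unit w₂ × χ w₂ ≡ e₂) × w₁ * t₁ + w₂ * t₂ ≈ c

  weightedSplit : ∀ {t₁ t₂ c} → Unit t₁ → Unit t₂ → Unit c → ∀ e₁ e₂ → WeightedSplit t₁ t₂ c e₁ e₂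
  weightedSplit {t₁} {t₂} u₁ u₂ uc e₁ e₂ =
    let u , v , uu , uv , u+v≈c , χu , χv = split uc (e₁ ⇔ᵇ χ t₁) (e₂ ⇔ᵇ χ t₂)
        w₁ , (uw₁ , χw₁) , w₁t₁≈u = divideBy u₁ uu
        w₂ , (uw₂ , χw₂) , w₂t₂≈v = divideBy u₂ uv
    in w₁ , w₂ ,
      (uw₁ , trans χw₁ (trans (cong (_⇔ᵇ χ t₁) χu) (⇔ᵇ-cancelʳ e₁ (χ t₁)))) ,
      (uw₂ , trans χw₂ (trans (cong (_⇔ᵇ χ t₂) χv) (⇔ᵇ-cancelʳ e₂ (χ t₂)))) ,
      ≈-trans (+-cong w₁t₁≈u w₂t₂≈v) u+v≈c

  prescribedZeroSum-divisible : ∀ {m} (t : Fin m → ℕ) → (∀ j → p ∣ t j) → ∀ e → PrescribedZeroSum t e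
  prescribedZeroSum-divisible t p∣t e = representative ∘ e , representatives-HasCharacters e ,
    ∑≈0 (λ j → ≈-trans (*-congˡ (representative (e j)) (∣⇒≈0 (p∣t j))) (≡⇒≈ (*-zeroʳ (representative (e j)))))

  pairRest : ∀ {m} → (Fin m → ℕ) → (Fin m → ℕ) → Fin m → Fin m → ℕ
  pairRest w t a b = w · t + neg (w a * t a + w b * t b)

  completeByPair : ∀ {m} (t : Fin m → ℕ) {a b} → a ≢ b → Unit (t a) → Unit (t b) →
    ∀ w {e} → HasCharacters w e → Unit (pairRest w t a b) → PrescribedZeroSum t e
  completeByPair {m} t {a} {b} a≢b ua ub w {e} hw uc = finish (weightedSplit ua ub (neg-Unit uc) (e a) (e b))
    where
    D c : ℕ
    D = w a * t a + w b * t b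
    c = w · t + neg D
    finish : WeightedSplit (t a) (t b) (neg c) (e a) (e b) → PrescribedZeroSum t e
    finish (x , y , hx , hy , xta+ytb≈-c) = W , []≔₂-elim w (λ j v → Unit v × χ v ≡ e j) hx hy (λ j _ _ → hw j) , (begin
        W · t                                ≡⟨ +-identityʳ (W · t) ⟨
        W · t + 0                            ≈⟨ +-congˡ (W · t) (+-neg≈0 D) ⟨
        W · t + (D + neg D)                  ≡⟨ +-assoc (W · t) D (neg D) ⟨
        W · t + D + neg D                    ≡⟨ cong (_+ neg D) (·-[]≔₂ w t a≢b x y) ⟩
        w · t + (x * t a + y * t b) + neg D  ≡⟨ +-CS.xy∙z≈xz∙y (w · t) _ (neg D) ⟩
        c + (x * t a + y * t b)              ≈⟨ +-congˡ c xta+ytb≈-c ⟩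
        c + neg c                            ≈⟨ +-neg≈0 c ⟩
        0                                    ∎)
      where
      open ≈-Reasoning
      W : Fin m → ℕ
      W = w [ a ]≔ x [ b ]≔ y

  -- If the rest of the sum vanishes, quadrupling the third weight keeps its character and makes the rest a unit.
  prescribedZeroSum-threeUnits : ∀ {m} (t : Fin m → ℕ) {j₁ j₂ j₃} → j₁ ≢ j₂ → j₁ ≢ j₃ → j₂ ≢ j₃ →
    Unit (t j₁) → Unit (t j₂) → Unit (t j₃) → ∀ e → PrescribedZeroSum t e
  prescribedZeroSum-threeUnits {m} t {j₁} {j₂} {j₃} j₁≢j₂ j₁≢j₃ j₂≢j₃ u₁ u₂ u₃ e with p ∣? pairRest (representative ∘ e) t j₁ j₂
  ... | no  p∤c₀ = completeByPair t j₁≢j₂ u₁ u₂ (representative ∘ e) (representatives-HasCharacters e) p∤c₀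
  ... | yes p∣c₀ = completeByPair t j₁≢j₂ u₁ u₂ w₁ hw₁ (subst Unit c₁≡ (Unit-resp-≈ (≈-sym c₁≈3r₃t₃) u[3r₃t₃]))
    where
    w₀ w₁ : Fin m → ℕ
    r₃ D c₀ : ℕ
    w₀ = representative ∘ e
    r₃ = w₀ j₃
    D  = w₀ j₁ * t j₁ + w₀ j₂ * t j₂
    c₀ = w₀ · t + neg D
    w₁ = w₀ [ j₃ ]≔ 4 * r₃
    hw₀ : HasCharacters w₀ e
    hw₀ = representatives-HasCharacters e
    u4 : Unit 4
    u4 = 0<x<p⇒Unit (s≤s z≤n) (n<p 4)
    hw₁ : HasCharacters w₁ e
    hw₁ j with j Fin.≟ j₃
    ... | yes refl = subst (λ v → Unit v × χ v ≡ e j) (sym (updateAt-updates j w₀))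
                       (*-Unit u4 (proj₁ (hw₀ j)) , trans (χ-* u4 (proj₁ (hw₀ j))) (trans (cong (_⇔ᵇ χ r₃) (χ-square 2)) (proj₂ (hw₀ j))))
    ... | no j≢j₃  = subst (λ v → Unit v × χ v ≡ e j) (sym (updateAt-minimal j j₃ w₀ j≢j₃)) (hw₀ j)
    c₁≡ : w₁ · t + neg D ≡ pairRest w₁ t j₁ j₂
    c₁≡ = cong (λ (x , y) → w₁ · t + neg (x * t j₁ + y * t j₂))
      (sym (cong₂ _,_ (updateAt-minimal j₁ j₃ w₀ j₁≢j₃) (updateAt-minimal j₂ j₃ w₀ j₂≢j₃)))
    u[3r₃t₃] : Unit (3 * (r₃ * t j₃))
    u[3r₃t₃] = *-Unit (0<x<p⇒Unit (s≤s z≤n) (n<p 3)) (*-Unit (proj₁ (hw₀ j₃)) u₃)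
    c₁≈3r₃t₃ : w₁ · t + neg D ≈ 3 * (r₃ * t j₃)
    c₁≈3r₃t₃ = +-cancelˡ-≈ {r₃ * t j₃} (begin
      r₃ * t j₃ + (w₁ · t + neg D)     ≡⟨ +-CS.x∙yz≈yx∙z (r₃ * t j₃) (w₁ · t) (neg D) ⟩
      w₁ · t + r₃ * t j₃ + neg D       ≡⟨ cong (_+ neg D) (·-[]≔ w₀ t j₃ (4 * r₃)) ⟩
      w₀ · t + 4 * r₃ * t j₃ + neg D   ≡⟨ +-CS.xy∙z≈xz∙y (w₀ · t) _ (neg D) ⟩
      c₀ + 4 * r₃ * t j₃               ≈⟨ +-congʳ (4 * r₃ * t j₃) (∣⇒≈0 p∣c₀) ⟩
      4 * r₃ * t j₃                    ≡⟨ split4 r₃ (t j₃) ⟩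
      r₃ * t j₃ + 3 * (r₃ * t j₃)      ∎)
      where
      open ≈-Reasoning
      split4 : ∀ r s → 4 * r * s ≡ r * s + 3 * (r * s)
      split4 = solve-∀

  -- With exactly two unit terms the weights are determined up to a common factor, so the character at b is forced.
  pairedWeight : ∀ {tb} → Unit tb → ℕ → ℕ
  pairedWeight ub ta = neg ta * proj₁ (inverse ub)

  prescribedZeroSum-twoUnits : ∀ {m} (t : Fin m → ℕ) {a b} → a ≢ b → Unit (t a) → (ub : Unit (t b)) →
    (∀ j → j ≢ a → j ≢ b → p ∣ t j) → ∀ e → e a ≡ true → e b ≡ χ (pairedWeight ub (t a)) → PrescribedZeroSum t e
  prescribedZeroSum-twoUnits {m} t {a} {b} a≢b ua ub p∣t e ea≡true eb≡χs =
    W , []≔₂-elim w₀ (λ j v → Unit v × χ v ≡ e j) (Unit-1 , trans χ-1 (sym ea≡true)) (us , sym eb≡χs) (λ j _ _ → hw₀ j) ,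
    ≈-trans (∑-cong W≈V) V·t≈0
    where
    i s : ℕ
    i = proj₁ (inverse ub)
    tbi≈1 : t b * i ≈ 1
    tbi≈1 = proj₂ (inverse ub)
    s = pairedWeight ub (t a)
    us : Unit s
    us = *-Unit (neg-Unit ua) (inverse⇒Unit {t b} tbi≈1)
    w₀ W V : Fin m → ℕ
    w₀ = representative ∘ e
    hw₀ : HasCharacters w₀ e
    hw₀ = representatives-HasCharacters e
    zeros : Fin m → ℕ
    zeros _ = 0
    W = w₀ [ a ]≔ 1 [ b ]≔ s
    V = zeros [ a ]≔ 1 [ b ]≔ s
    W≈V : ∀ j → W j * t j ≈ V j * t j
    W≈V = []≔₂-elim w₀ (λ j v → v * t j ≈ V j * t j)
      (≡⇒≈ (cong (_* t a) (sym ([]≔₂-at₁ zeros a≢b))))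
      (≡⇒≈ (cong (_* t b) (sym ([]≔₂-at₂ zeros))))
      (λ j j≢a j≢b → ≈-trans (*-congˡ (w₀ j) (∣⇒≈0 (p∣t j j≢a j≢b)))
                     (≈-trans (≡⇒≈ (trans (*-zeroʳ (w₀ j)) (sym (*-zeroʳ (V j))))) (*-congˡ (V j) (≈-sym (∣⇒≈0 (p∣t j j≢a j≢b))))))
    V·t≈0 : V · t ≈ 0
    V·t≈0 = begin
      V · t                          ≡⟨ +-identityʳ (V · t) ⟨
      V · t + 0                      ≡⟨ ·-[]≔₂ zeros t a≢b 1 s ⟩
      zeros · t + (1 * t a + s * t b) ≈⟨ +-congʳ (1 * t a + s * t b) (∑≈0 {f = λ j → zeros j * t j} (λ _ → ≈-refl)) ⟩
      1 * t a + s * t b              ≡⟨ cong₂ _+_ (*-identityˡ (t a)) (*-CS.xy∙z≈x∙zy (neg (t a)) i (t b)) ⟩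
      t a + neg (t a) * (t b * i)    ≈⟨ +-congˡ (t a) (*-congˡ (neg (t a)) tbi≈1) ⟩
      t a + neg (t a) * 1            ≡⟨ cong (t a +_) (*-identityʳ (neg (t a))) ⟩
      t a + neg (t a)                ≈⟨ +-neg≈0 (t a) ⟩
      0                              ∎
      where open ≈-Reasoning

-- The Chinese remainder theorem and the Jacobi symbol

chineseRemainder-byInverse : ∀ a b .{{_ : NonZero a}} .{{_ : NonZero b}} c → (c * a) % b ≡ 1 % b →
  ∀ x y → ∃ λ z → z % a ≡ x % a × z % b ≡ y % b
chineseRemainder-byInverse a b c ca≡1 x y = x + a * k , z≡x , ≈⇒%≡ z≈y
  where
  open Congruence b
  k : ℕ
  k = (y + neg x) * c
  z≡x : (x + a * k) % a ≡ x % a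
  z≡x = trans (cong (λ w → (x + w) % a) (*-comm a k)) ([m+kn]%n≡m%n x k a)
  z≈y : x + a * k ≈ y
  z≈y = begin
    x + a * ((y + neg x) * c)   ≡⟨ cong (x +_) (*-CS.x∙yz≈y∙zx a (y + neg x) c) ⟩
    x + (y + neg x) * (c * a)   ≈⟨ +-congˡ x (*-congˡ (y + neg x) (mk≈ ca≡1)) ⟩
    x + (y + neg x) * 1         ≡⟨ cong (x +_) (*-identityʳ (y + neg x)) ⟩
    x + (y + neg x)             ≡⟨ +-CS.x∙yz≈y∙xz x y (neg x) ⟩
    y + (x + neg x)             ≈⟨ +-congˡ y (+-neg≈0 x) ⟩
    y + 0                       ≡⟨ +-identityʳ y ⟩
    y                           ∎
    where open ≈-Reasoning

chineseRemainder₂ : ∀ a b .{{_ : NonZero a}} .{{_ : NonZero b}} → Coprime a b →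
  ∀ x y → ∃ λ z → z % a ≡ x % a × z % b ≡ y % b
chineseRemainder₂ a b a⊥b x y with coprime-Bézout a⊥b
... | GCD.Bézout.+- u v eq = chineseRemainder-byInverse a b u (trans (sym (cong (_% b) eq)) ([m+kn]%n≡m%n 1 v b)) x y
... | GCD.Bézout.-+ u v eq =
  let z , z≡y , z≡x = chineseRemainder-byInverse b a v (trans (sym (cong (_% a) eq)) ([m+kn]%n≡m%n 1 u a)) y x
  in z , z≡x , z≡y

lookup-Prime : ∀ {qs} → All Prime qs → ∀ i → Prime (lookup qs i)
lookup-Prime {qs} ps i = All.lookup ps (∈-lookup {xs = qs} i)

prime⊥product : ∀ {q qs} → Prime q → All Prime qs → All (q ≢_) qs → Coprime q (product qs)
prime⊥product pq ps q∉qs {d} (d∣q , d∣Π) with prime⇒irreducible pq d∣q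
... | inj₁ d≡1 = d≡1
... | inj₂ refl = contradiction refl (All.lookup q∉qs (factorisationHasAllPrimeFactors pq d∣Π ps))

product∣ : ∀ {qs} → All Prime qs → Unique qs → ∀ {s} → (∀ i → lookup qs i ∣ s) → product qs ∣ s
product∣ {[]}     _        _           {s} _     = divides s (sym (*-identityʳ s))
product∣ {q ∷ qs} (pq ∷ ps) (q∉qs ∷ uqs) {s} qᵢ∣s with divides o s≡oΠ ← product∣ ps uqs (qᵢ∣s ∘ suc)
  with divides o′ o≡o′q ← coprime-divisor (prime⊥product pq ps q∉qs) (subst (q ∣_) (trans s≡oΠ (*-comm o (product qs))) (qᵢ∣s zero))
  = divides o′ (trans s≡oΠ (trans (cong (_* product qs) o≡o′q) (*-assoc o′ q (product qs))))

Coprime-product : ∀ {qs} → All Prime qs → ∀ {x} → (∀ i → ¬ (lookup qs i ∣ x)) → Coprime x (product qs)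
Coprime-product {qs} ps {x} qᵢ∤x {d} (d∣x , d∣Π) = go (PrimeFactorisation.factors f) (PrimeFactorisation.isFactorisation f) (PrimeFactorisation.factorsPrime f)
  where
  instance
    d≢0 : NonZero d
    d≢0 = ≢-nonZero (λ d≡0 → ≢-nonZero⁻¹ (product qs) {{productOfPrimes≢0 ps}} (0∣⇒≡0 (subst (_∣ product qs) d≡0 d∣Π)))
  f : PrimeFactorisation d
  f = factorise d
  go : ∀ fs → d ≡ product fs → All Prime fs → d ≡ 1
  go []       d≡1 _         = d≡1
  go (r ∷ fs) d≡Π (pr ∷ _) = ⊥-elim (qᵢ∤x (index r∈qs) (subst (_∣ x) (lookup-index r∈qs) (∣-trans r∣d d∣x)))
    where
    r∣d : r ∣ d
    r∣d = subst (r ∣_) (sym d≡Π) (m∣m*n (product fs))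
    r∈qs : r ∈ qs
    r∈qs = factorisationHasAllPrimeFactors pr (∣-trans r∣d d∣Π) ps

chineseRemainder : ∀ {qs} (ps : All Prime qs) → Unique qs → (r : Fin (length qs) → ℕ) →
  ∃ λ W → ∀ i → PrimeModulus._≈_ (lookup-Prime ps i) W (r i)
chineseRemainder {[]}     _        _           r = 0 , λ ()
chineseRemainder {q ∷ qs} (pq ∷ ps) (q∉qs ∷ uqs) r = z , residue
  where
  instance
    q≢0 : NonZero q
    q≢0 = prime⇒nonZero pq
    Π≢0 : NonZero (product qs)
    Π≢0 = productOfPrimes≢0 ps
  W′ z : ℕ
  W′ = proj₁ (chineseRemainder ps uqs (r ∘ suc))
  z,eqs : ∃ λ z → z % q ≡ r zero % q × z % product qs ≡ W′ % product qs
  z,eqs = chineseRemainder₂ q (product qs) (prime⊥product pq ps q∉qs) (r zero) W′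
  z = proj₁ z,eqs
  residue : ∀ i → PrimeModulus._≈_ (lookup-Prime (pq ∷ ps) i) z (r i)
  residue zero    = mk≈ (proj₁ (proj₂ z,eqs))
    where open PrimeModulus pq
  residue (suc i) = mk≈ (begin
    z % qᵢ                    ≡⟨ m∣n⇒o%n%m≡o%m qᵢ (product qs) z qᵢ∣Π ⟨
    z % product qs % qᵢ       ≡⟨ cong (_% qᵢ) (proj₂ (proj₂ z,eqs)) ⟩
    W′ % product qs % qᵢ      ≡⟨ m∣n⇒o%n%m≡o%m qᵢ (product qs) W′ qᵢ∣Π ⟩
    W′ % qᵢ                   ≡⟨ ≈⇒%≡ (proj₂ (chineseRemainder ps uqs (r ∘ suc)) i) ⟩
    r (suc i) % qᵢ            ∎)
    where
    open ≡-Reasoning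
    open PrimeModulus (lookup-Prime ps i)
    qᵢ : ℕ
    qᵢ = lookup qs i
    qᵢ∣Π : qᵢ ∣ product qs
    qᵢ∣Π = ∈⇒∣product (∈-lookup {xs = qs} i)

module XorCS = CommutativeSemigroupProperties
  (CommutativeMonoid.commutativeSemigroup (AbelianGroup.commutativeMonoid (CommutativeRing.+-abelianGroup Bool.xor-∧-commutativeRing)))

parity : ∀ {k} → (Fin k → Bool) → Bool
parity = Vec.foldr _xor_ false

parity-cong : ∀ {k} {f g : Fin k → Bool} → (∀ i → f i ≡ g i) → parity f ≡ parity g
parity-cong {zero}  _   = refl
parity-cong {suc k} f≗g = cong₂ _xor_ (f≗g zero) (parity-cong (f≗g ∘ suc))

parity-xor : ∀ {k} (f g : Fin k → Bool) → parity (λ i → f i xor g i) ≡ parity f xor parity g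
parity-xor {zero}  f g = refl
parity-xor {suc k} f g = trans (cong ((f zero xor g zero) xor_) (parity-xor (f ∘ suc) (g ∘ suc))) (XorCS.interchange (f zero) (g zero) _ _)

parity-false : ∀ {k} {f : Fin k → Bool} → (∀ i → f i ≡ false) → parity f ≡ false
parity-false {zero}          _    = refl
parity-false {suc k} {f} f≡false rewrite f≡false zero = parity-false (f≡false ∘ suc)

parity-single : ∀ {k} (f : Fin k → Bool) i₀ → (∀ i → i ≢ i₀ → f i ≡ false) → parity f ≡ f i₀
parity-single {suc k} f zero     f≡false = trans (cong (f zero xor_) (parity-false (λ i → f≡false (suc i) λ ()))) (Bool.xor-identityʳ (f zero))
parity-single {suc k} f (suc i₀) f≡false rewrite f≡false zero (λ ()) = parity-single (f ∘ suc) i₀ (λ i i≢i₀ → f≡false (suc i) (i≢i₀ ∘ Fin.suc-injective))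

sign : Bool → ℤ
sign true  = -1ℤ
sign false = 1ℤ

jacobiOver-↭ : ∀ a {ps qs} → ps ↭ qs → jacobiOver a ps ≡ jacobiOver a qs
jacobiOver-↭ a ↭-refl             = refl
jacobiOver-↭ a (↭-prep x ps↭qs)   = cong (legendre a x ℤ.*_) (jacobiOver-↭ a ps↭qs)
jacobiOver-↭ a (↭-swap x y ps↭qs) = trans (ℤ-*-CS.x∙yz≈y∙xz (legendre a x) (legendre a y) _)
  (cong (λ j → legendre a y ℤ.* (legendre a x ℤ.* j)) (jacobiOver-↭ a ps↭qs))
jacobiOver-↭ a (↭-trans p₁ p₂)    = trans (jacobiOver-↭ a p₁) (jacobiOver-↭ a p₂)

jacobiOver≡sign : ∀ a qs → jacobiOver a qs ≡ sign (parity (λ i → not (isQR a (lookup qs i))))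
jacobiOver≡sign a []       = refl
jacobiOver≡sign a (q ∷ qs) = trans (cong (legendre a q ℤ.*_) (jacobiOver≡sign a qs)) (legendre*sign (isQR a q) _)
  where
  legendre*sign : ∀ b c → (if b then 1ℤ else -1ℤ) ℤ.* sign c ≡ sign (not b xor c)
  legendre*sign true  true  = refl
  legendre*sign true  false = refl
  legendre*sign false true  = refl
  legendre*sign false false = refl

jacobi≡1 : ∀ {n qs} → All Prime qs → product qs ≡ n → ∀ a → parity (λ i → not (isQR a (lookup qs i))) ≡ false →
  ∀ ps → IsFactorisation n ps → jacobiOver a ps ≡ 1ℤ
jacobi≡1 {n} {qs} qsPrime Πqs≡n a even ps (psPrime , Πps≡n) = begin
  jacobiOver a ps                                       ≡⟨ jacobiOver-↭ a (factorisationUnique fps fqs) ⟩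
  jacobiOver a qs                                       ≡⟨ jacobiOver≡sign a qs ⟩
  sign (parity (λ i → not (isQR a (lookup qs i))))      ≡⟨ cong sign even ⟩
  1ℤ                                                    ∎
  where
  open ≡-Reasoning
  fps fqs : PrimeFactorisation n
  fps = record { factors = ps ; isFactorisation = sym Πps≡n ; factorsPrime = psPrime }
  fqs = record { factors = qs ; isFactorisation = sym Πqs≡n ; factorsPrime = qsPrime }

-- Choosing the characters so that every weight has Jacobi symbol 1

infix 4 _==_
_==_ : ∀ {m} → Fin m → Fin m → Bool
a == b = does (a Fin.≟ b)

==-refl : ∀ {m} (a : Fin m) → (a == a) ≡ true
==-refl a with a Fin.≟ a
... | yes _   = refl
... | no a≢a = contradiction refl a≢a

==-≢ : ∀ {m} {a b : Fin m} → a ≢ b → (a == b) ≡ false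
==-≢ {a = a} {b} a≢b with a Fin.≟ b
... | yes a≡b = contradiction a≡b a≢b
... | no _    = refl

-- Each pair fixes the character true at its first position and a forced one at its second; all other
-- characters are free. At each position j, the free character at the prime `corrector j` absorbs the
-- product of the forced characters at j, and positions without a corrector are never second in a pair.
module ParityCorrection {k m} (isPair : Fin k → Bool) (first second : Fin k → Fin m) (forced : Fin k → Bool)
  (corrector : Fin m → Maybe (Fin k))
  (first≢second : ∀ i → isPair i ≡ true → first i ≢ second i)
  (corrector-free : ∀ j i → corrector j ≡ just i → isPair i ≡ true → first i ≢ j × second i ≢ j)
  (uncorrected-not-second : ∀ j → corrector j ≡ nothing → ∀ i → isPair i ≡ true → second i ≢ j) where

  forcedDefect : Fin k → Fin m → Bool
  forcedDefect i j = isPair i ∧ ((second i == j) ∧ not (forced i))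

  free : Fin k → Fin m → Bool
  free i j with corrector j
  ... | just i′ = if i == i′ then not (parity (λ i → forcedDefect i j)) else true
  ... | nothing = true

  character : Fin k → Fin m → Bool
  character i j = if isPair i then (if first i == j then true else (if second i == j then forced i else free i j)) else free i j

  free-true : ∀ i j → corrector j ≢ just i → free i j ≡ true
  free-true i j ≢just with corrector j
  ... | nothing = refl
  ... | just i′ with i Fin.≟ i′
  ...   | yes refl = contradiction refl ≢just
  ...   | no _     = refl

  not-character : ∀ i j → not (character i j) ≡ forcedDefect i j xor not (free i j)
  not-character i j with isPair i in pair
  ... | false = refl
  ... | true with first i Fin.≟ j | second i Fin.≟ j
  ...   | yes refl | yes i₂≡j = contradiction (sym i₂≡j) (first≢second i pair)
  ...   | yes refl | no _ rewrite free-true i (first i) (λ c≡i → proj₁ (corrector-free (first i) i c≡i pair) refl) = refl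
  ...   | no _ | yes refl rewrite free-true i (second i) (λ c≡i → proj₂ (corrector-free (second i) i c≡i pair) refl) =
    sym (Bool.xor-identityʳ (not (forced i)))
  ...   | no _ | no _ = refl

  parity-not-free : ∀ j → parity (λ i → not (free i j)) ≡ parity (λ i → forcedDefect i j)
  parity-not-free j with corrector j in c
  ... | just i′ = trans (parity-single _ i′ (λ i i≢i′ → cong not (free-elsewhere i i≢i′)))
                        (trans (cong (λ b → not (if b then not (parity (λ i → forcedDefect i j)) else true)) (==-refl i′))
                               (Bool.not-involutive _))
    where
    free-elsewhere : ∀ i → i ≢ i′ → (if i == i′ then not (parity (λ i → forcedDefect i j)) else true) ≡ true
    free-elsewhere i i≢i′ rewrite ==-≢ i≢i′ = refl
  ... | nothing = trans (parity-false {k} {λ _ → false} (λ _ → refl)) (sym (parity-false no-defect))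
    where
    no-defect : ∀ i → forcedDefect i j ≡ false
    no-defect i with isPair i in pair
    ... | false = refl
    ... | true rewrite ==-≢ (uncorrected-not-second j c i pair) = refl

  parity-character : ∀ j → parity (λ i → not (character i j)) ≡ false
  parity-character j = begin
    parity (λ i → not (character i j))                              ≡⟨ parity-cong (λ i → not-character i j) ⟩
    parity (λ i → forcedDefect i j xor not (free i j))              ≡⟨ parity-xor (λ i → forcedDefect i j) (λ i → not (free i j)) ⟩
    parity (λ i → forcedDefect i j) xor parity (λ i → not (free i j)) ≡⟨ cong (parity (λ i → forcedDefect i j) xor_) (parity-not-free j) ⟩
    parity (λ i → forcedDefect i j) xor parity (λ i → forcedDefect i j) ≡⟨ Bool.xor-same (parity (λ i → forcedDefect i j)) ⟩
    false                                                           ∎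
    where open ≡-Reasoning

count : ∀ {m} → (Fin m → Bool) → ℕ
count {zero}  f = 0
count {suc m} f = (if f zero then 1 else 0) + count (f ∘ suc)

count-lookup : ∀ (g : A → Bool) (xs : List A) → count (λ j → g (lookup xs j)) ≡ length (filterᵇ g xs)
count-lookup g []       = refl
count-lookup g (x ∷ xs) with g x
... | true  = cong suc (count-lookup g xs)
... | false = count-lookup g xs

count-none : ∀ {m} {f : Fin m → Bool} → (∀ j → f j ≡ false) → count f ≡ 0
count-none {zero}  _       = refl
count-none {suc m} f≡false rewrite f≡false zero = count-none (f≡false ∘ suc)

count-single : ∀ {m} {f : Fin m → Bool} a → f a ≡ true → (∀ j → j ≢ a → f j ≡ false) → count f ≡ 1
count-single {suc m} zero    fa f≡false rewrite fa = cong suc (count-none (λ j → f≡false (suc j) λ ()))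
count-single {suc m} (suc a) fa f≡false rewrite f≡false zero (λ ()) =
  count-single a fa (λ j j≢a → f≡false (suc j) (j≢a ∘ Fin.suc-injective))

count-pair : ∀ {m} {f : Fin m → Bool} a b → a ≢ b → f a ≡ true → f b ≡ true → (∀ j → j ≢ a → j ≢ b → f j ≡ false) → count f ≡ 2
count-pair {suc m} zero    zero    a≢b _  _  _       = contradiction refl a≢b
count-pair {suc m} zero    (suc b) _   fa fb f≡false rewrite fa =
  cong suc (count-single b fb (λ j j≢b → f≡false (suc j) (λ ()) (j≢b ∘ Fin.suc-injective)))
count-pair {suc m} (suc a) zero    _   fa fb f≡false rewrite fb =
  cong suc (count-single a fa (λ j j≢a → f≡false (suc j) (j≢a ∘ Fin.suc-injective) (λ ())))
count-pair {suc m} (suc a) (suc b) a≢b fa fb f≡false rewrite f≡false zero (λ ()) (λ ()) =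
  count-pair a b (a≢b ∘ cong suc) fa fb (λ j j≢a j≢b → f≡false (suc j) (j≢a ∘ Fin.suc-injective) (j≢b ∘ Fin.suc-injective))

data Support {m} (f : Fin m → Bool) : Set where
  none   : (∀ j → f j ≡ false) → Support f
  single : ∀ a → f a ≡ true → (∀ j → j ≢ a → f j ≡ false) → Support f
  pair   : ∀ a b → a ≢ b → f a ≡ true → f b ≡ true → (∀ j → j ≢ a → j ≢ b → f j ≡ false) → Support f
  many   : ∀ a b c → a ≢ b → a ≢ c → b ≢ c → f a ≡ true → f b ≡ true → f c ≡ true → Support f

support : ∀ {m} (f : Fin m → Bool) → Support f
support {zero}  f = none (λ ())
support {suc m} f with support (f ∘ suc) | f zero in f0
... | none f≡false | false = none λ { zero → f0 ; (suc j) → f≡false j }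
... | none f≡false | true  = single zero f0 λ { zero 0≢0 → contradiction refl 0≢0 ; (suc j) _ → f≡false j }
... | single a fa f≡false | false = single (suc a) fa λ { zero _ → f0 ; (suc j) j≢a → f≡false j (j≢a ∘ cong suc) }
... | single a fa f≡false | true  = pair zero (suc a) (λ ()) f0 fa
  λ { zero 0≢0 _ → contradiction refl 0≢0 ; (suc j) _ j≢a → f≡false j (j≢a ∘ cong suc) }
... | pair a b a≢b fa fb f≡false | false = pair (suc a) (suc b) (a≢b ∘ Fin.suc-injective) fa fb
  λ { zero _ _ → f0 ; (suc j) j≢a j≢b → f≡false j (j≢a ∘ cong suc) (j≢b ∘ cong suc) }
... | pair a b a≢b fa fb _ | true = many zero (suc a) (suc b) (λ ()) (λ ()) (a≢b ∘ Fin.suc-injective) f0 fa fb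
... | many a b c a≢b a≢c b≢c fa fb fc | _ =
  many (suc a) (suc b) (suc c) (a≢b ∘ Fin.suc-injective) (a≢c ∘ Fin.suc-injective) (b≢c ∘ Fin.suc-injective) fa fb fc

isPair : ∀ {m} {f : Fin m → Bool} → Support f → Bool
isPair (pair _ _ _ _ _ _) = true
isPair _                  = false

first second : ∀ {m} {f : Fin (suc m) → Bool} → Support f → Fin (suc m)
first (pair a _ _ _ _ _) = a
first _                  = zero
second (pair _ b _ _ _ _) = b
second _                  = zero

pair-distinct : ∀ {m} {f : Fin (suc m) → Bool} (s : Support f) → isPair s ≡ true → first s ≢ second s
pair-distinct (pair _ _ a≢b _ _ _) _ = a≢b

pair-true : ∀ {m} {f : Fin (suc m) → Bool} (s : Support f) → isPair s ≡ true → f (first s) ≡ true × f (second s) ≡ true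
pair-true (pair _ _ _ fa fb _) _ = fa , fb

pair-count : ∀ {m} {f : Fin m → Bool} (s : Support f) → isPair s ≡ true → count f ≡ 2
pair-count (pair a b a≢b fa fb f≡false) _ = count-pair a b a≢b fa fb f≡false

orient : ∀ {m} {f : Fin m → Bool} → (Fin m → Bool) → Support f → Support f
orient avoid (pair a b a≢b fa fb f≡false) with avoid b
... | true  = pair b a (a≢b ∘ sym) fb fa (λ j j≢b j≢a → f≡false j j≢a j≢b)
... | false = pair a b a≢b fa fb f≡false
orient avoid s = s

isPair-orient : ∀ {m} {f : Fin m → Bool} (avoid : Fin m → Bool) (s : Support f) → isPair (orient avoid s) ≡ isPair s
isPair-orient avoid (none _)               = refl
isPair-orient avoid (single _ _ _)         = refl
isPair-orient avoid (pair _ b _ _ _ _) with avoid b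
... | true  = refl
... | false = refl
isPair-orient avoid (many _ _ _ _ _ _ _ _ _) = refl

second-orient : ∀ {m} {f : Fin (suc m) → Bool} (avoid : Fin (suc m) → Bool) →
  (∀ a b → avoid a ≡ true → avoid b ≡ true → a ≡ b) →
  (s : Support f) → isPair (orient avoid s) ≡ true → avoid (second (orient avoid s)) ≡ false
second-orient avoid atMostOne (pair a b a≢b _ _ _) _ with avoid b in avoid-b
... | false = avoid-b
... | true with avoid a in avoid-a
...   | false = refl
...   | true  = contradiction (atMostOne a b avoid-a avoid-b) a≢b

allᶠ : ∀ {k} → (Fin k → Bool) → Bool
allᶠ = Vec.foldr _∧_ true

allᶠ-elim : ∀ {k} (f : Fin k → Bool) → allᶠ f ≡ true → ∀ i → f i ≡ true
allᶠ-elim {suc k} f all≡true i with f zero in f0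
allᶠ-elim {suc k} f all≡true zero    | true = f0
allᶠ-elim {suc k} f all≡true (suc i) | true = allᶠ-elim (f ∘ suc) all≡true i

allᶠ-intro : ∀ {k} (f : Fin k → Bool) → (∀ i → f i ≡ true) → allᶠ f ≡ true
allᶠ-intro {zero}  f _      = refl
allᶠ-intro {suc k} f f≡true rewrite f≡true zero = allᶠ-intro (f ∘ suc) (f≡true ∘ suc)

findᶠ : ∀ {k} → (Fin k → Bool) → Maybe (Fin k)
findᶠ {zero}  f = nothing
findᶠ {suc k} f = if f zero then just zero else Maybe.map suc (findᶠ (f ∘ suc))

findᶠ-just : ∀ {k} (f : Fin k → Bool) {i} → findᶠ f ≡ just i → f i ≡ true
findᶠ-just {suc k} f found with f zero in f0 | findᶠ (f ∘ suc) in rest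
findᶠ-just {suc k} f refl | true  | _      = f0
findᶠ-just {suc k} f refl | false | just i = findᶠ-just (f ∘ suc) rest

findᶠ-nothing : ∀ {k} (f : Fin k → Bool) → findᶠ f ≡ nothing → ∀ i → f i ≡ false
findᶠ-nothing {suc k} f notFound i with f zero in f0 | findᶠ (f ∘ suc) in rest
findᶠ-nothing {suc k} f refl zero    | false | nothing = f0
findᶠ-nothing {suc k} f refl (suc i) | false | nothing = findᶠ-nothing (f ∘ suc) rest i

infix 4 _∤ᵇ_
_∤ᵇ_ : ℕ → ℕ → Bool
q ∤ᵇ x = not (does (q ∣? x))

∤ᵇ-true : ∀ {q x} → (q ∤ᵇ x) ≡ true → ¬ (q ∣ x)
∤ᵇ-true {q} {x} q∤x with q ∣? x
... | no q∤x′ = q∤x′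

∤ᵇ-false : ∀ {q x} → (q ∤ᵇ x) ≡ false → q ∣ x
∤ᵇ-false {q} {x} _ with q ∣? x
... | yes q∣x = q∣x

weightedSum : ∀ {n} → List (Fin n) → List (Fin n) → ℕ
weightedSum ws ys = sum (zipWith (λ w y → toℕ w * toℕ y) ws ys)

module _ {n : ℕ} (q : ℕ) where

  supportSize : List (Fin n) → ℕ
  supportSize ys = length (filterᵇ (λ y → q ∤ᵇ toℕ y) ys)

  supportSize≡0⇒∣weightedSum : ∀ (ws ys : List (Fin n)) → length ws ≡ length ys → supportSize ys ≡ 0 → q ∣ weightedSum ws ys
  supportSize≡0⇒∣weightedSum []       []       _     _ = q ∣0
  supportSize≡0⇒∣weightedSum (w ∷ ws) (y ∷ ys) |ws|≡ size≡0 with q ∤ᵇ toℕ y in q∤y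
  ... | false = ∣m∣n⇒∣m+n (∣n⇒∣m*n (toℕ w) (∤ᵇ-false q∤y)) (supportSize≡0⇒∣weightedSum ws ys (suc-injective |ws|≡) size≡0)

  unitWeights⇒supportSize≢1 : Prime q → ∀ (ws ys : List (Fin n)) → All (λ w → ¬ (q ∣ toℕ w)) ws → length ws ≡ length ys →
    q ∣ weightedSum ws ys → supportSize ys ≢ 1
  unitWeights⇒supportSize≢1 pq [] [] _ _ _ ()
  unitWeights⇒supportSize≢1 pq (w ∷ ws) (y ∷ ys) (q∤w ∷ q∤ws) |ws|≡ q∣Σ with q ∤ᵇ toℕ y in q∤y
  ... | false = unitWeights⇒supportSize≢1 pq ws ys q∤ws (suc-injective |ws|≡) (∣m+n∣m⇒∣n q∣Σ (∣n⇒∣m*n (toℕ w) (∤ᵇ-false q∤y)))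
  ... | true  = λ size≡1 → isolated (suc-injective size≡1)
    where
    isolated : supportSize ys ≡ 0 → ⊥
    isolated size≡0 with euclidsLemma (toℕ w) (toℕ y) pq
      (∣m+n∣m⇒∣n (subst (q ∣_) (+-comm (toℕ w * toℕ y) _) q∣Σ) (supportSize≡0⇒∣weightedSum ws ys (suc-injective |ws|≡) size≡0))
    ... | inj₁ q∣w = q∤w q∣w
    ... | inj₂ q∣y = ∤ᵇ-true q∤y q∣y

-- Linear dependence over GF(2)

insert : ℕ → Bool → List Bool → List Bool
insert zero    c M       = c ∷ M
insert (suc j) c []      = c ∷ []
insert (suc j) c (b ∷ M) = b ∷ insert j c M

length-insert : ∀ j c M → j ≤ length M → length (insert j c M) ≡ suc (length M)
length-insert zero    c M       _         = refl
length-insert (suc j) c (b ∷ M) (s≤s j≤) = cong suc (length-insert j c M j≤)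

or-insert : ∀ j c M → or M ≡ true → or (insert j c M) ≡ true
or-insert zero    true  M           _    = refl
or-insert zero    false M           some = some
or-insert (suc j) c     (true ∷ M)  _    = refl
or-insert (suc j) c     (false ∷ M) some = or-insert j c M some

parityᴸ : (A → Bool) → List A → Bool
parityᴸ t = foldr (λ x b → t x xor b) false

length-filterᵇ≡1⇒parityᴸ : ∀ (t : A → Bool) ys → length (filterᵇ t ys) ≡ 1 → parityᴸ t ys ≡ true
length-filterᵇ≡1⇒parityᴸ t (y ∷ ys) size≡1 with t y
... | true  = cong not (parity≡false ys (suc-injective size≡1))
  where
  parity≡false : ∀ ys → length (filterᵇ t ys) ≡ 0 → parityᴸ t ys ≡ false
  parity≡false []       _ = refl
  parity≡false (y ∷ ys) size≡0 with t y
  ... | false = parity≡false ys size≡0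
... | false = length-filterᵇ≡1⇒parityᴸ t ys size≡1

parityᴸ-map : ∀ (t : B → Bool) (f : A → B) xs → parityᴸ t (map f xs) ≡ parityᴸ (t ∘ f) xs
parityᴸ-map t f []       = refl
parityᴸ-map t f (x ∷ xs) = cong (t (f x) xor_) (parityᴸ-map t f xs)

parityᴸ-false : ∀ (t : A → Bool) {xs} → All (λ x → t x ≡ false) xs → parityᴸ t xs ≡ false
parityᴸ-false t []           = refl
parityᴸ-false t (tx≡false ∷ all-false) rewrite tx≡false = parityᴸ-false t all-false

select : List Bool → List A → List A
select []          _        = []
select (_ ∷ _)     []       = []
select (true  ∷ M) (x ∷ xs) = x ∷ select M xs
select (false ∷ M) (x ∷ xs) = select M xs

select-⊆ : ∀ M (xs : List A) → select M xs ⊆ xs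
select-⊆ []          xs       = minimum xs
select-⊆ (_ ∷ _)     []       = []
select-⊆ (true ∷ M)  (x ∷ xs) = refl ∷ select-⊆ M xs
select-⊆ (false ∷ M) (x ∷ xs) = x ∷ʳ select-⊆ M xs

select-nonempty : ∀ M (xs : List A) → length M ≡ length xs → or M ≡ true → select M xs ≢ []
select-nonempty (true  ∷ M) (x ∷ xs) _       _    ()
select-nonempty (false ∷ M) (x ∷ xs) |M|≡|xs| some = select-nonempty M xs (suc-injective |M|≡|xs|) some

select-map : ∀ (f : A → B) M xs → select M (map f xs) ≡ map f (select M xs)
select-map f []          xs       = refl
select-map f (_ ∷ _)     []       = refl
select-map f (true  ∷ M) (x ∷ xs) = cong (f x ∷_) (select-map f M xs)
select-map f (false ∷ M) (x ∷ xs) = select-map f M xs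

firstTrue : ∀ (t : A → Bool) xs → All (λ x → t x ≡ false) xs ⊎ ∃₂ λ pre v → ∃ λ post → xs ≡ pre ++ v ∷ post × t v ≡ true
firstTrue t []       = inj₁ []
firstTrue t (x ∷ xs) with t x in tx
... | true  = inj₂ ([] , x , xs , refl , tx)
... | false with firstTrue t xs
...   | inj₁ all-false                   = inj₁ (tx ∷ all-false)
...   | inj₂ (pre , v , post , refl , tv) = inj₂ (x ∷ pre , v , post , refl , tv)

parityᴸ-select-insert : ∀ (t : A → Bool) pre post v c M → length M ≡ length (pre ++ post) →
  parityᴸ t (select (insert (length pre) c M) (pre ++ v ∷ post)) ≡ parityᴸ t (select M (pre ++ post)) xor (c ∧ t v)
parityᴸ-select-insert t []        post v true  M _ = Bool.xor-comm (t v) _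
parityᴸ-select-insert t []        post v false M _ = sym (Bool.xor-identityʳ _)
parityᴸ-select-insert t (x ∷ pre) post v c (true ∷ M) |M|≡ =
  trans (cong (t x xor_) (parityᴸ-select-insert t pre post v c M (suc-injective |M|≡))) (sym (Bool.xor-assoc (t x) _ _))
parityᴸ-select-insert t (x ∷ pre) post v c (false ∷ M) |M|≡ = parityᴸ-select-insert t pre post v c M (suc-injective |M|≡)

eliminate : ∀ {k} → (Fin (suc k) → Bool) → (Fin (suc k) → Bool) → Fin (suc k) → Bool
eliminate pivot v i = v i xor (v zero ∧ pivot i)

parityᴸ-eliminate : ∀ {k} (pivot : Fin (suc k) → Bool) vs i →
  parityᴸ (λ v → eliminate pivot v i) vs ≡ parityᴸ (λ v → v i) vs xor (parityᴸ (λ v → v zero) vs ∧ pivot i)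
parityᴸ-eliminate pivot []       i = refl
parityᴸ-eliminate pivot (v ∷ vs) i = begin
  (v i xor (v zero ∧ pivot i)) xor parityᴸ (λ v → eliminate pivot v i) vs
    ≡⟨ cong ((v i xor (v zero ∧ pivot i)) xor_) (parityᴸ-eliminate pivot vs i) ⟩
  (v i xor (v zero ∧ pivot i)) xor (P xor (Z ∧ pivot i))
    ≡⟨ XorCS.interchange (v i) (v zero ∧ pivot i) P (Z ∧ pivot i) ⟩
  (v i xor P) xor ((v zero ∧ pivot i) xor (Z ∧ pivot i))
    ≡⟨ cong ((v i xor P) xor_) (Bool.∧-distribʳ-xor (pivot i) (v zero) Z) ⟨
  (v i xor P) xor ((v zero xor Z) ∧ pivot i)  ∎
  where
  open ≡-Reasoning
  P Z : Bool
  P = parityᴸ (λ v → v i) vs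
  Z = parityᴸ (λ v → v zero) vs

-- Gaussian elimination: a vector with first coordinate true clears that coordinate from all the others.
evenSelection : ∀ k (vs : List (Fin k → Bool)) → k < length vs →
  ∃ λ M → length M ≡ length vs × or M ≡ true × (∀ i → parityᴸ (λ v → v i) (select M vs) ≡ false)
evenSelection zero    (v ∷ vs) _ = true ∷ replicate (length vs) false , cong suc (length-replicate (length vs)) , refl , λ ()
evenSelection (suc k) vs k<|vs| with firstTrue (λ v → v zero) vs
... | inj₁ all-false =
  let M , |M|≡ , some , even = evenSelection k (map (_∘ suc) vs) (subst (k <_) (sym (length-map (_∘ suc) vs)) (<⇒<suc k<|vs|))
  in M , trans |M|≡ (length-map (_∘ suc) vs) , some , λ where
       zero    → parityᴸ-false (λ v → v zero) (All-select M all-false)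
       (suc i) → trans (sym (parityᴸ-map (λ w → w i) (_∘ suc) (select M vs)))
                   (trans (cong (parityᴸ (λ w → w i)) (sym (select-map (_∘ suc) M vs))) (even i))
  where
  <⇒<suc : ∀ {k l} → suc k < l → k < l
  <⇒<suc = <-trans (n<1+n _)
  All-select : ∀ {A : Set} {P : A → Set} M {xs} → All P xs → All P (select M xs)
  All-select M all = All-resp-⊆ (select-⊆ M _) all
... | inj₂ (pre , pivot , post , refl , pivot₀) =
  let M′ , |M′|≡ , some , even′ = evenSelection k (map reduce rest) k<|rest|
      |M′|≡|rest| : length M′ ≡ length rest
      |M′|≡|rest| = trans |M′|≡ (length-map reduce rest)
      c : Bool
      c = parityᴸ (λ v → v zero) (select M′ rest)
  in insert (length pre) c M′ ,
     trans (length-insert (length pre) c M′ (subst (length pre ≤_) (sym |M′|≡|rest|) (subst (length pre ≤_) (sym (length-++ pre)) (m≤m+n _ _))))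
           (trans (cong suc |M′|≡|rest|) (sym (length-++-∷ pre post))) ,
     or-insert (length pre) c M′ some ,
     λ where
       zero    → trans (parityᴸ-select-insert (λ v → v zero) pre post pivot c M′ |M′|≡|rest|)
                       (trans (cong (λ b → c xor (c ∧ b)) pivot₀) (trans (cong (c xor_) (Bool.∧-identityʳ c)) (Bool.xor-same c)))
       (suc i) → begin
         parityᴸ (λ v → v (suc i)) (select (insert (length pre) c M′) (pre ++ pivot ∷ post))
           ≡⟨ parityᴸ-select-insert (λ v → v (suc i)) pre post pivot c M′ |M′|≡|rest| ⟩
         parityᴸ (λ v → v (suc i)) (select M′ rest) xor (c ∧ pivot (suc i))
           ≡⟨ parityᴸ-eliminate pivot (select M′ rest) (suc i) ⟨
         parityᴸ (λ v → eliminate pivot v (suc i)) (select M′ rest)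
           ≡⟨ parityᴸ-map (λ w → w i) reduce (select M′ rest) ⟨
         parityᴸ (λ w → w i) (map reduce (select M′ rest))
           ≡⟨ cong (parityᴸ (λ w → w i)) (select-map reduce M′ rest) ⟨
         parityᴸ (λ w → w i) (select M′ (map reduce rest))
           ≡⟨ even′ i ⟩
         false ∎
  where
  open ≡-Reasoning
  rest : List (Fin (suc k) → Bool)
  rest = pre ++ post
  reduce : (Fin (suc k) → Bool) → Fin k → Bool
  reduce v = eliminate pivot v ∘ suc
  length-++-∷ : ∀ {A : Set} (pre : List A) {x} post → length (pre ++ x ∷ post) ≡ suc (length (pre ++ post))
  length-++-∷ pre post = trans (length-++ pre) (trans (+-suc _ _) (cong suc (sym (length-++ pre))))
  k<|rest| : k < length (map reduce rest)
  k<|rest| = subst (k <_) (sym (length-map reduce rest)) (≤-pred (subst (suc k <_) (length-++-∷ pre post) k<|vs|))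

-- Davenport constants of ℤ_n

initialProducts : List ℕ → List ℕ
initialProducts []       = []
initialProducts (q ∷ qs) = 1 ∷ map (q *_) (initialProducts qs)

length-initialProducts : ∀ qs → length (initialProducts qs) ≡ length qs
length-initialProducts []       = refl
length-initialProducts (q ∷ qs) = cong suc (trans (length-map (q *_) (initialProducts qs)) (length-initialProducts qs))

⊆-map⁻ : ∀ (f : A → B) {ys} xs → ys ⊆ map f xs → ∃ λ zs → ys ≡ map f zs × zs ⊆ xs
⊆-map⁻ f []       []        = [] , refl , []
⊆-map⁻ f (x ∷ xs) (_ ∷ʳ ys⊆) with zs , refl , zs⊆ ← ⊆-map⁻ f xs ys⊆ = zs , refl , x ∷ʳ zs⊆
⊆-map⁻ f (x ∷ xs) (refl ∷ ys⊆) with zs , refl , zs⊆ ← ⊆-map⁻ f xs ys⊆ = x ∷ zs , refl , refl ∷ zs⊆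

∤ᵇ-multiple : ∀ q xs → length (filterᵇ (q ∤ᵇ_) (map (q *_) xs)) ≡ 0
∤ᵇ-multiple q []       = refl
∤ᵇ-multiple q (x ∷ xs) with q ∣? q * x
... | yes _   = ∤ᵇ-multiple q xs
... | no q∤qx = contradiction (m∣m*n x) q∤qx

∤ᵇ-*-coprime : ∀ {q′ q} → Prime q′ → Prime q → q′ ≢ q → ∀ x → (q′ ∤ᵇ q * x) ≡ (q′ ∤ᵇ x)
∤ᵇ-*-coprime {q′} {q} pq′ pq q′≢q x with q′ ∣? q * x | q′ ∣? x
... | yes _     | yes _     = refl
... | no _      | no _      = refl
... | no q′∤qx  | yes q′∣x  = contradiction (∣n⇒∣m*n q q′∣x) q′∤qx
... | yes q′∣qx | no q′∤x with euclidsLemma q x pq′ q′∣qx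
...   | inj₂ q′∣x = contradiction q′∣x q′∤x
...   | inj₁ q′∣q with prime⇒irreducible pq q′∣q
...     | inj₁ refl = contradiction pq′ ¬prime[1]
...     | inj₂ q′≡q = contradiction q′≡q q′≢q

length-filterᵇ-∤ᵇ-* : ∀ {q′ q} → Prime q′ → Prime q → q′ ≢ q → ∀ xs →
  length (filterᵇ (q′ ∤ᵇ_) (map (q *_) xs)) ≡ length (filterᵇ (q′ ∤ᵇ_) xs)
length-filterᵇ-∤ᵇ-* pq′ pq q′≢q []       = refl
length-filterᵇ-∤ᵇ-* {q′} pq′ pq q′≢q (x ∷ xs) rewrite ∤ᵇ-*-coprime pq′ pq q′≢q x with q′ ∤ᵇ x
... | true  = cong suc (length-filterᵇ-∤ᵇ-* pq′ pq q′≢q xs)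
... | false = length-filterᵇ-∤ᵇ-* pq′ pq q′≢q xs

-- The first selected product is the only selected one not divisible by the prime that follows it.
initialProducts-isolated : ∀ {qs} → All Prime qs → Unique qs → ∀ {ys} → ys ⊆ initialProducts qs → ys ≢ [] →
  ∃ λ i → length (filterᵇ (lookup qs i ∤ᵇ_) ys) ≡ 1
initialProducts-isolated {[]} _ _ [] ys≢[] = contradiction refl ys≢[]
initialProducts-isolated {q ∷ qs} (pq ∷ _) _ (refl ∷ ys⊆) _ with zs , refl , _ ← ⊆-map⁻ (q *_) (initialProducts qs) ys⊆
  = zero , isolated-head zs
  where
  isolated-head : ∀ zs → length (filterᵇ (q ∤ᵇ_) (1 ∷ map (q *_) zs)) ≡ 1
  isolated-head zs with q ∣? 1
  ... | yes q∣1 = contradiction (subst Prime (∣1⇒≡1 q∣1) pq) ¬prime[1]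
  ... | no _    = cong suc (∤ᵇ-multiple q zs)
initialProducts-isolated {q ∷ qs} (pq ∷ ps) (q∉qs ∷ uqs) (_ ∷ʳ ys⊆) ys≢[]
  with zs , refl , zs⊆ ← ⊆-map⁻ (q *_) (initialProducts qs) ys⊆
  with i , isolated ← initialProducts-isolated ps uqs zs⊆ (ys≢[] ∘ cong (map (q *_)))
  = suc i , trans (length-filterᵇ-∤ᵇ-* (lookup-Prime ps i) pq (λ qᵢ≡q → All.lookup q∉qs (∈-lookup {xs = qs} i) (sym qᵢ≡q)) zs) isolated

length-filterᵇ-∷ : ∀ (g : A → Bool) x xs → length (filterᵇ g (x ∷ xs)) ≡ (if g x then 1 else 0) + length (filterᵇ g xs)
length-filterᵇ-∷ g x xs with g x
... | true  = refl
... | false = refl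

lookup₂-⊆ : ∀ (ys : List A) a b → toℕ a < toℕ b → lookup ys a ∷ lookup ys b ∷ [] ⊆ ys
lookup₂-⊆ (y ∷ ys) zero    (suc b) _         = refl ∷ from∈ (∈-lookup {xs = ys} b)
lookup₂-⊆ (y ∷ ys) (suc a) (suc b) (s≤s a<b) = y ∷ʳ lookup₂-⊆ ys a b a<b

length-filterᵇ-pair : ∀ (g : A → Bool) {x y} → g x ≡ true → g y ≡ true → length (filterᵇ g (x ∷ y ∷ [])) ≡ 2
length-filterᵇ-pair g gx gy rewrite gx | gy = refl

pairSublist : ∀ (ys : List A) {a b : Fin (length ys)} → a ≢ b → ∃ λ ys₂ → ys₂ ⊆ ys × length ys₂ ≡ 2 ×
  (∀ g → g (lookup ys a) ≡ true → g (lookup ys b) ≡ true → length (filterᵇ g ys₂) ≡ 2)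
pairSublist ys {a} {b} a≢b with <-cmp (toℕ a) (toℕ b)
... | tri< a<b _ _ = lookup ys a ∷ lookup ys b ∷ [] , lookup₂-⊆ ys a b a<b , refl , λ g ga gb → length-filterᵇ-pair g ga gb
... | tri≈ _ a≡b _ = contradiction (Fin.toℕ-injective a≡b) a≢b
... | tri> _ _ b<a = lookup ys b ∷ lookup ys a ∷ [] , lookup₂-⊆ ys b a b<a , refl , λ g ga gb → length-filterᵇ-pair g gb ga

extendSublist : ∀ {ys xs : List A} → ys ⊆ xs → length ys < length xs →
  ∃₂ λ z z₀ → ∃ λ zs → z ∈ xs × z₀ ∷ zs ⊆ xs × (∀ g → length (filterᵇ g (z₀ ∷ zs)) ≡ length (filterᵇ g (z ∷ ys)))
extendSublist {ys = ys} {xs = x ∷ xs} (_ ∷ʳ ys⊆) _ = x , x , ys , here refl , refl ∷ ys⊆ , λ g → refl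
extendSublist {ys = y ∷ ys} {xs = y ∷ xs} (refl ∷ ys⊆) (s≤s |ys|<) =
  let z , z₀ , zs , z∈ , ⊆xs , counts = extendSublist ys⊆ |ys|<
  in z , y , z₀ ∷ zs , there z∈ , refl ∷ ⊆xs , λ g → begin
    length (filterᵇ g (y ∷ z₀ ∷ zs))                  ≡⟨ length-filterᵇ-∷ g y (z₀ ∷ zs) ⟩
    bit (g y) + length (filterᵇ g (z₀ ∷ zs))         ≡⟨ cong (bit (g y) +_) (trans (counts g) (length-filterᵇ-∷ g z ys)) ⟩
    bit (g y) + (bit (g z) + length (filterᵇ g ys))  ≡⟨ +-CS.x∙yz≈y∙xz (bit (g y)) (bit (g z)) _ ⟩
    bit (g z) + (bit (g y) + length (filterᵇ g ys))  ≡⟨ cong (bit (g z) +_) (length-filterᵇ-∷ g y ys) ⟨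
    bit (g z) + length (filterᵇ g (y ∷ ys))          ≡⟨ length-filterᵇ-∷ g z (y ∷ ys) ⟨
    length (filterᵇ g (z ∷ y ∷ ys))                  ∎
  where
  open ≡-Reasoning
  bit : Bool → ℕ
  bit b = if b then 1 else 0

sum-zipWith-tabulate : ∀ (g : A → B → ℕ) (ys : List B) (h : Fin (length ys) → A) →
  sum (zipWith g (tabulate h) ys) ≡ ∑ (λ j → g (h j) (lookup ys j))
sum-zipWith-tabulate g []       h = refl
sum-zipWith-tabulate g (y ∷ ys) h = cong (g (h zero) y +_) (sum-zipWith-tabulate g ys (h ∘ suc))

module Sequences (n : ℕ) {qs : List ℕ} (qsPrime : All Prime qs) (qs≥7 : All (7 ≤_) qs) (qsUnique : Unique qs)
  (Πqs≡n : product qs ≡ n) where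

  k : ℕ
  k = length qs

  q : Fin k → ℕ
  q = lookup qs

  module Mod (i : Fin k) = PrimeAtLeast7 (lookup-Prime qsPrime i) (All.lookup qs≥7 (∈-lookup {xs = qs} i))

  instance
    n≢0 : NonZero n
    n≢0 = subst NonZero Πqs≡n (productOfPrimes≢0 qsPrime)

  q∣n : ∀ i → q i ∣ n
  q∣n i = subst (q i ∣_) Πqs≡n (∈⇒∣product (∈-lookup {xs = qs} i))

  U⇒Unit : ∀ i {w : Fin n} → U n w → Mod.Unit i (toℕ w)
  U⇒Unit i w⊥n q∣w = ¬prime[1] (subst Prime (w⊥n (q∣w , q∣n i)) (lookup-Prime qsPrime i))

  zeroSum⇒supportSize≢1 : ∀ {ys} → WeightedZeroSum n (U n) ys → ∀ i → supportSize (q i) ys ≢ 1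
  zeroSum⇒supportSize≢1 {ys} (ws , wsU , |ws|≡ , n∣Σ) i =
    unitWeights⇒supportSize≢1 (q i) (lookup-Prime qsPrime i) ws ys (All.map (U⇒Unit i) wsU) |ws|≡ (∣-trans (q∣n i) n∣Σ)

  values : (T : List (Fin n)) → Fin (length T) → ℕ
  values T j = toℕ (lookup T j)

  localToGlobal : ∀ T (c : Fin k → Fin (length T) → Bool) → (∀ j → parity (λ i → not (c i j)) ≡ false) →
    (∀ i → Mod.PrescribedZeroSum i (values T) (c i)) → WeightedZeroSum n (S n) T
  localToGlobal T c even local = tabulate W , AllP.tabulate⁺ W∈S , length-tabulate W , n∣Σ
    where
    w : Fin k → Fin (length T) → ℕ
    w i = proj₁ (local i)
    crt : Fin (length T) → ℕ
    crt j = proj₁ (chineseRemainder qsPrime qsUnique (λ i → w i j))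
    W : Fin (length T) → Fin n
    W j = crt j mod n
    W≈w : ∀ j i → Mod._≈_ i (toℕ (W j)) (w i j)
    W≈w j i = mk≈ (begin
      toℕ (W j) % q i          ≡⟨ cong (_% q i) (Fin.toℕ-fromℕ< (m%n<n (crt j) n)) ⟩
      crt j % n % q i          ≡⟨ m∣n⇒o%n%m≡o%m (q i) n (crt j) (q∣n i) ⟩
      crt j % q i              ≡⟨ ≈⇒%≡ (proj₂ (chineseRemainder qsPrime qsUnique (λ i → w i j)) i) ⟩
      w i j % q i              ∎)
      where
      open ≡-Reasoning
      open Mod i using (mk≈; ≈⇒%≡; p≢0)
    W∈S : ∀ j → S n (W j)
    W∈S j = subst (Coprime (toℕ (W j))) Πqs≡n (Coprime-product qsPrime (λ i → Mod.Unit-resp-≈ i (Mod.≈-sym i (W≈w j i)) (proj₁ (proj₁ (proj₂ (local i)) j)))) ,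
            jacobi≡1 qsPrime Πqs≡n (toℕ (W j)) (trans (parity-cong χW≡c) (even j))
      where
      χW≡c : ∀ i → not (isQR (toℕ (W j)) (q i)) ≡ not (c i j)
      χW≡c i = cong not (trans (Mod.χ-resp-≈ i (W≈w j i)) (proj₂ (proj₁ (proj₂ (local i)) j)))
    n∣Σ : n ∣ weightedSum (tabulate W) T
    n∣Σ = subst (n ∣_) (sym (sum-zipWith-tabulate (λ w y → toℕ w * toℕ y) T W))
      (subst (_∣ ∑ (λ j → toℕ (W j) * values T j)) Πqs≡n (product∣ qsPrime qsUnique q∣Σ))
      where
      q∣Σ : ∀ i → q i ∣ ∑ (λ j → toℕ (W j) * values T j)
      q∣Σ i = Mod.≈0⇒∣ i (Mod.≈-trans i (Mod.∑-cong i (λ j → Mod.*-congʳ i (values T j) (W≈w j i))) (proj₂ (proj₂ (local i))))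

  module Construction (x₀ : Fin n) (T′ : List (Fin n)) where

    xs : List (Fin n)
    xs = x₀ ∷ T′

    nonzeroAt : Fin k → Fin (length xs) → Bool
    nonzeroAt i j = q i ∤ᵇ values xs j

    -- Pinned positions have no
    -- corrector, so pairs are oriented to put them first, which is possible when there is at most one.
    pinned : Fin (length xs) → Bool
    pinned j = allᶠ (λ i → isPair (support (nonzeroAt i)) ∧ nonzeroAt i j)

    oriented : ∀ i → Support (nonzeroAt i)
    oriented i = orient pinned (support (nonzeroAt i))

    forcedFor : ∀ i → Support (nonzeroAt i) → Bool
    forcedFor i (pair a b _ _ fb _) = Mod.χ i (Mod.pairedWeight i (∤ᵇ-true fb) (values xs a))
    forcedFor i _                   = false

    corrector : Fin (length xs) → Maybe (Fin k)
    corrector j = findᶠ (λ i → not (isPair (oriented i) ∧ nonzeroAt i j))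

    count≡supportSize : ∀ i → count (nonzeroAt i) ≡ supportSize (q i) xs
    count≡supportSize i = count-lookup (λ y → q i ∤ᵇ toℕ y) xs

    pinned⇒pair : ∀ {j} → pinned j ≡ true → ∀ i → isPair (support (nonzeroAt i)) ≡ true × nonzeroAt i j ≡ true
    pinned⇒pair j-pinned i = ∧-elim (allᶠ-elim _ j-pinned i)
      where
      ∧-elim : ∀ {a b} → a ∧ b ≡ true → a ≡ true × b ≡ true
      ∧-elim {true} {true} _ = refl , refl

    pinned⇒supportSize≡2 : ∀ {j} → pinned j ≡ true → ∀ i → supportSize (q i) xs ≡ 2
    pinned⇒supportSize≡2 {j} j-pinned i = trans (sym (count≡supportSize i)) (pair-count (support (nonzeroAt i)) (proj₁ (pinned⇒pair {j} j-pinned i)))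

    module Solution (atMostOnePinned : ∀ a b → pinned a ≡ true → pinned b ≡ true → a ≡ b)
                    (noIsolated : ∀ i → count (nonzeroAt i) ≢ 1) where

      corrector-free : ∀ j i → corrector j ≡ just i → isPair (oriented i) ≡ true →
        first (oriented i) ≢ j × second (oriented i) ≢ j
      corrector-free j i found paired = (λ i₁≡j → true≢false (trans (sym (proj₁ nonzero)) (trans (cong (nonzeroAt i) i₁≡j) zeroAt))) ,
                                       (λ i₂≡j → true≢false (trans (sym (proj₂ nonzero)) (trans (cong (nonzeroAt i) i₂≡j) zeroAt)))
        where
        nonzero : nonzeroAt i (first (oriented i)) ≡ true × nonzeroAt i (second (oriented i)) ≡ true
        nonzero = pair-true (oriented i) paired
        zeroAt : nonzeroAt i j ≡ false
        zeroAt = not-injective (subst (λ b → not (b ∧ nonzeroAt i j) ≡ true) paired (findᶠ-just _ found))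
        true≢false : true ≢ false
        true≢false ()

      uncorrected-not-second : ∀ j → corrector j ≡ nothing → ∀ i → isPair (oriented i) ≡ true → second (oriented i) ≢ j
      uncorrected-not-second j notFound i paired i₂≡j =
        contradiction (trans (sym (second-orient pinned atMostOnePinned (support (nonzeroAt i)) paired)) (trans (cong pinned i₂≡j) j-pinned)) λ ()
        where
        j-pinned : pinned j ≡ true
        j-pinned = allᶠ-intro _ (λ i′ → subst (λ b → b ∧ nonzeroAt i′ j ≡ true) (isPair-orient pinned (support (nonzeroAt i′)))
                     (Bool.not-injective (findᶠ-nothing _ notFound i′)))

      open ParityCorrection (λ i → isPair (oriented i)) (λ i → first (oriented i)) (λ i → second (oriented i))
        (λ i → forcedFor i (oriented i)) corrector (λ i → pair-distinct (oriented i)) corrector-free uncorrected-not-second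

      characterFor : ∀ i → Support (nonzeroAt i) → Fin (length xs) → Bool
      characterFor i s j = if isPair s then (if first s == j then true else (if second s == j then forcedFor i s else free i j)) else free i j

      localFor : ∀ i (s : Support (nonzeroAt i)) → Mod.PrescribedZeroSum i (values xs) (characterFor i s)
      localFor i (none zeros) = Mod.prescribedZeroSum-divisible i (values xs) (λ j → ∤ᵇ-false (zeros j)) _
      localFor i (single a fa zeros) = contradiction (count-single a fa zeros) (noIsolated i)
      localFor i s@(pair a b a≢b fa fb zeros) = Mod.prescribedZeroSum-twoUnits i (values xs) a≢b (∤ᵇ-true fa) (∤ᵇ-true fb)
        (λ j j≢a j≢b → ∤ᵇ-false (zeros j j≢a j≢b)) _
        (cong (λ c → if c then true else (if b == a then forcedFor i s else free i a)) (==-refl a))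
        (trans (cong (λ c → if c then true else (if b == b then forcedFor i s else free i b)) (==-≢ a≢b))
               (cong (λ c → if c then forcedFor i s else free i b) (==-refl b)))
      localFor i (many a b c a≢b a≢c b≢c fa fb fc) =
        Mod.prescribedZeroSum-threeUnits i (values xs) a≢b a≢c b≢c (∤ᵇ-true fa) (∤ᵇ-true fb) (∤ᵇ-true fc) _

      zeroSum : WeightedZeroSum n (S n) xs
      zeroSum = localToGlobal xs character parity-character (λ i → localFor i (oriented i))

    zeroSum : (∀ a b → pinned a ≡ true → pinned b ≡ true → a ≡ b) → (∀ i → supportSize (q i) xs ≢ 1) → WeightedZeroSum n (S n) xs
    zeroSum atMostOnePinned noIsolated = Solution.zeroSum atMostOnePinned (λ i c≡1 → noIsolated i (trans (sym (count≡supportSize i)) c≡1))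

  S⇒U : ∀ {xs} → HasWZSSub n (S n) xs → HasWZSSub n (U n) xs
  S⇒U (ys , ys⊆ , ys≢[] , ws , wsS , |ws|≡ , n∣Σ) = ys , ys⊆ , ys≢[] , ws , All.map proj₁ wsS , |ws|≡ , n∣Σ

  divisibleByAll⇒≡0 : ∀ (z : Fin n) → (∀ i → q i ∣ toℕ z) → toℕ z ≡ 0
  divisibleByAll⇒≡0 z qᵢ∣z = ∣∧<⇒≡0 (subst (_∣ toℕ z) Πqs≡n (product∣ qsPrime qsUnique qᵢ∣z)) (Fin.toℕ<n z)

  zeroElement : ∀ x → toℕ x ≡ 0 → WeightedZeroSum n (S n) (x ∷ [])
  zeroElement x x≡0 = Construction.zeroSum x [] (λ { zero zero _ _ → refl }) (λ i → 0≢1 ∘ trans (sym (supportSize≡0 i)))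
    where
    0≢1 : 0 ≢ 1
    0≢1 ()
    supportSize≡0 : ∀ i → supportSize (q i) (x ∷ []) ≡ 0
    supportSize≡0 i rewrite x≡0 with q i ∣? 0
    ... | yes _   = refl
    ... | no q∤0 = contradiction (q i ∣0) q∤0

  nonzeroAt : Fin k → Fin n → Bool
  nonzeroAt i y = q i ∤ᵇ toℕ y

  zeroSum-pairsPlusOne : ∀ z z₀ zs → toℕ z ≢ 0 →
    (∀ i → supportSize (q i) (z₀ ∷ zs) ≡ (if q i ∤ᵇ toℕ z then 1 else 0) + 2) → WeightedZeroSum n (S n) (z₀ ∷ zs)
  zeroSum-pairsPlusOne z z₀ zs z≢0 size≡ = Construction.zeroSum z₀ zs noPinned (λ i → size≢1 i)
    where
    size≢1 : ∀ i → supportSize (q i) (z₀ ∷ zs) ≢ 1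
    size≢1 i size≡1 with q i ∤ᵇ toℕ z | size≡ i
    ... | true  | size≡3 = contradiction (trans (sym size≡1) size≡3) λ ()
    ... | false | size≡2 = contradiction (trans (sym size≡1) size≡2) λ ()
    z-zeroAt : ∀ {a} → Construction.pinned z₀ zs a ≡ true → ∀ i → (q i ∤ᵇ toℕ z) ≡ false
    z-zeroAt {a} a-pinned i with q i ∤ᵇ toℕ z | trans (sym (Construction.pinned⇒supportSize≡2 z₀ zs {a} a-pinned i)) (size≡ i)
    ... | false | _ = refl
    ... | true  | ()
    noPinned : ∀ a b → Construction.pinned z₀ zs a ≡ true → Construction.pinned z₀ zs b ≡ true → a ≡ b
    noPinned a _ a-pinned _ = contradiction (divisibleByAll⇒≡0 z (λ i → ∤ᵇ-false (z-zeroAt {a} a-pinned i))) z≢0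

  -- With two pinned positions every prime sees exactly these two terms; any third, nonzero term breaks this.
  twoPinned : ∀ {xs} → 3 ≤ length xs → (∀ {z} → z ∈ xs → toℕ z ≢ 0) → ∀ y₀ ys′ → y₀ ∷ ys′ ⊆ xs →
    ∀ {a b} → a ≢ b → Construction.pinned y₀ ys′ a ≡ true → Construction.pinned y₀ ys′ b ≡ true → HasWZSSub n (S n) xs
  twoPinned {xs} 3≤|xs| nonzero y₀ ys′ ys⊆ {a} {b} a≢b a-pinned b-pinned =
    let ys₂ , ys₂⊆ , |ys₂|≡2 , size₂ = pairSublist (y₀ ∷ ys′) a≢b
        z , z₀ , zs , z∈ , zs⊆ , sizes = extendSublist (⊆-trans ys₂⊆ ys⊆) (subst (_< length xs) (sym |ys₂|≡2) 3≤|xs|)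
        size≡ : ∀ i → supportSize (q i) (z₀ ∷ zs) ≡ (if q i ∤ᵇ toℕ z then 1 else 0) + 2
        size≡ i = trans (sizes (nonzeroAt i)) (trans (length-filterᵇ-∷ (nonzeroAt i) z ys₂) (cong ((if nonzeroAt i z then 1 else 0) +_)
          (size₂ (nonzeroAt i) (proj₂ (Construction.pinned⇒pair y₀ ys′ {a} a-pinned i)) (proj₂ (Construction.pinned⇒pair y₀ ys′ {b} b-pinned i)))))
    in z₀ ∷ zs , zs⊆ , (λ ()) , zeroSum-pairsPlusOne z z₀ zs (nonzero z∈) size≡

  hasZeroSumSubsequence : ∀ xs → 3 ≤ length xs → ∀ {ys} → ys ⊆ xs → ys ≢ [] → (∀ i → supportSize (q i) ys ≢ 1) →
    HasWZSSub n (S n) xs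
  hasZeroSumSubsequence xs 3≤|xs| {ys} ys⊆ ys≢[] noIsolated with Any.any? (λ x → toℕ x ≟ 0) xs
  ... | yes has0 = let x , x∈ , x≡0 = find has0 in x ∷ [] , from∈ x∈ , (λ ()) , zeroElement x x≡0
  ... | no no0 with ys
  ...   | []       = contradiction refl ys≢[]
  ...   | y₀ ∷ ys′ with Fin.any? (λ a → Fin.any? (λ b → ¬? (a Fin.≟ b) ×-dec (pinned a Bool.≟ true) ×-dec (pinned b Bool.≟ true)))
    where pinned = Construction.pinned y₀ ys′
  ...     | yes (a , b , a≢b , a-pinned , b-pinned) = twoPinned 3≤|xs| (λ z∈ z≡0 → no0 (Any.map (λ { refl → z≡0 }) z∈)) y₀ ys′ ys⊆ a≢b a-pinned b-pinned
  ...     | no ¬twoPinned = y₀ ∷ ys′ , ys⊆ , ys≢[] , Construction.zeroSum y₀ ys′ atMostOnePinned noIsolated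
    where
    atMostOnePinned : ∀ a b → Construction.pinned y₀ ys′ a ≡ true → Construction.pinned y₀ ys′ b ≡ true → a ≡ b
    atMostOnePinned a b a-pinned b-pinned with a Fin.≟ b
    ... | yes a≡b = a≡b
    ... | no a≢b  = contradiction (a , b , a≢b , a-pinned , b-pinned) ¬twoPinned

  upperBound : 3 ≤ k → AllOfLengthHave n (S n) (suc k)
  upperBound 3≤k xs |xs|≡1+k =
    let M , |M|≡ , some , even = evenSelection k (map nonzeroVector xs) (subst (k <_) (sym (trans (length-map nonzeroVector xs) |xs|≡1+k)) ≤-refl)
    in hasZeroSumSubsequence xs (subst (3 ≤_) (sym |xs|≡1+k) (m≤n⇒m≤1+n 3≤k)) (select-⊆ M xs)
         (select-nonempty M xs (trans |M|≡ (length-map nonzeroVector xs)) some) (noIsolated M even)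
    where
    nonzeroVector : Fin n → Fin k → Bool
    nonzeroVector x i = nonzeroAt i x
    noIsolated : ∀ M → (∀ i → parityᴸ (λ v → v i) (select M (map nonzeroVector xs)) ≡ false) → ∀ i → supportSize (q i) (select M xs) ≢ 1
    noIsolated M even i size≡1 = contradiction (begin
      true                                                     ≡⟨ length-filterᵇ≡1⇒parityᴸ (nonzeroAt i) (select M xs) size≡1 ⟨
      parityᴸ (nonzeroAt i) (select M xs)                      ≡⟨ parityᴸ-map (λ v → v i) nonzeroVector (select M xs) ⟨
      parityᴸ (λ v → v i) (map nonzeroVector (select M xs))    ≡⟨ cong (parityᴸ (λ v → v i)) (select-map nonzeroVector M xs) ⟨
      parityᴸ (λ v → v i) (select M (map nonzeroVector xs))    ≡⟨ even i ⟩
      false                                                    ∎) λ ()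
      where open ≡-Reasoning

  nonzeroAt-mod : ∀ i y → nonzeroAt i (y mod n) ≡ (q i ∤ᵇ y)
  nonzeroAt-mod i y rewrite Fin.toℕ-fromℕ< (m%n<n y n) with q i ∣? y % n | q i ∣? y
  ... | yes _     | yes _   = refl
  ... | no _      | no _    = refl
  ... | yes q∣y%n | no q∤y  = contradiction (∣n∣m%n⇒∣m (q∣n i) q∣y%n) q∤y
  ... | no q∤y%n  | yes q∣y = contradiction (%-presˡ-∣ q∣y (q∣n i)) q∤y%n

  supportSize-mod : ∀ i ys → supportSize (q i) (map (_mod n) ys) ≡ length (filterᵇ (q i ∤ᵇ_) ys)
  supportSize-mod i []       = refl
  supportSize-mod i (y ∷ ys) rewrite nonzeroAt-mod i y with q i ∤ᵇ y
  ... | true  = cong suc (supportSize-mod i ys)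
  ... | false = supportSize-mod i ys

  lowerBound : ∀ m → m ≤ k → ∃ λ xs → length xs ≡ m × ¬ HasWZSSub n (U n) xs
  lowerBound m m≤k = map (_mod n) products , |products|≡m , noZeroSum
    where
    products : List ℕ
    products = take m (initialProducts qs)
    |products|≡m : length (map (_mod n) products) ≡ m
    |products|≡m = trans (length-map (_mod n) products)
      (trans (length-take m (initialProducts qs)) (trans (cong (m ⊓_) (length-initialProducts qs)) (m≤n⇒m⊓n≡m m≤k)))
    noZeroSum : ¬ HasWZSSub n (U n) (map (_mod n) products)
    noZeroSum (ys , ys⊆ , ys≢[] , zeroSum) with zs , refl , zs⊆ ← ⊆-map⁻ (_mod n) products ys⊆
      with i , isolated ← initialProducts-isolated qsPrime qsUnique (⊆-trans zs⊆ (take-⊆ m (initialProducts qs))) (ys≢[] ∘ cong (map (_mod n)))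
      = zeroSum⇒supportSize≢1 zeroSum i (trans (supportSize-mod i zs) isolated)

  Davenport : (A : Subset n) → (∀ {xs} → HasWZSSub n (S n) xs → HasWZSSub n A xs) → (∀ {xs} → HasWZSSub n A xs → HasWZSSub n (U n) xs) →
    3 ≤ k → IsDavenport n A (suc k)
  Davenport A S⇒A A⇒U 3≤k = (λ xs |xs|≡ → S⇒A (upperBound 3≤k xs |xs|≡)) , minimal
    where
    minimal : ∀ m → AllOfLengthHave n A m → suc k ≤ m
    minimal m allHave with suc k ≤? m
    ... | yes 1+k≤m = 1+k≤m
    ... | no 1+k≰m with xs , |xs|≡m , noZeroSum ← lowerBound m (≤-pred (≰⇒> 1+k≰m)) = contradiction (A⇒U (allHave xs |xs|≡m)) noZeroSum

  IsDavenport-unique : ∀ {A d d′} → IsDavenport n A d → IsDavenport n A d′ → d ≡ d′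
  IsDavenport-unique (allHave , minimal) (allHave′ , minimal′) = ≤-antisym (minimal _ allHave′) (minimal′ _ allHave)

  extremal-S⇔U : 3 ≤ k → ∀ xs → (Extremal n (S n) xs → Extremal n (U n) xs) × (Extremal n (U n) xs → Extremal n (S n) xs)
  extremal-S⇔U 3≤k xs = S⇒U-extremal , U⇒S-extremal
    where
    D-S : IsDavenport n (S n) (suc k)
    D-S = Davenport (S n) id S⇒U 3≤k
    D-U : IsDavenport n (U n) (suc k)
    D-U = Davenport (U n) S⇒U id 3≤k
    S⇒U-extremal : Extremal n (S n) xs → Extremal n (U n) xs
    S⇒U-extremal (d , D , |xs|+1≡d , noS) = suc k , D-U , |xs|+1≡1+k , noU
      where
      |xs|+1≡1+k = trans |xs|+1≡d (IsDavenport-unique D D-S)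
      noU : ¬ HasWZSSub n (U n) xs
      noU (ys , ys⊆ , ys≢[] , zeroSum) = noS (hasZeroSumSubsequence xs
        (subst (3 ≤_) (sym (suc-injective (trans (+-comm 1 (length xs)) |xs|+1≡1+k))) 3≤k) ys⊆ ys≢[] (zeroSum⇒supportSize≢1 zeroSum))
    U⇒S-extremal : Extremal n (U n) xs → Extremal n (S n) xs
    U⇒S-extremal (d , D , |xs|+1≡d , noU) = suc k , D-S , trans |xs|+1≡d (IsDavenport-unique D D-U) , noU ∘ S⇒U

squarefree⇒Unique : ∀ {qs} → All Prime qs → (∀ p → Prime p → ¬ (p * p ∣ product qs)) → Unique qs
squarefree⇒Unique {[]}     []         _          = []
squarefree⇒Unique {q ∷ qs} (pq ∷ ps) squarefree =
  All.tabulate q≢ ∷ squarefree⇒Unique ps (λ p pp p²∣Π → squarefree p pp (∣n⇒∣m*n q p²∣Π))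
  where
  q≢ : ∀ {r} → r ∈ qs → q ≢ r
  q≢ q∈qs refl with divides c Π≡cq ← ∈⇒∣product q∈qs =
    squarefree q pq (divides c (trans (cong (q *_) Π≡cq) (*-CS.x∙yz≈y∙xz q c q)))

mainTheorem4 : (n : ℕ) → Odd n → Squarefree n → ΩAtLeast 3 n
    → (∀ p → Prime p → p ∣ n → 7 ≤ p)
    → (xs : List (Fin n))
    → (Extremal n (S n) xs → Extremal n (U n) xs) × (Extremal n (U n) xs → Extremal n (S n) xs)
-- Oddness of n already follows from the bound on its prime divisors.
mainTheorem4 n _ squarefree (qs , (qsPrime , Πqs≡n) , 3≤|qs|) divisors≥7 =
  Sequences.extremal-S⇔U n qsPrime qs≥7 qsUnique Πqs≡n 3≤|qs|
  where
  qs≥7 : All (7 ≤_) qs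
  qs≥7 = All.tabulate λ {q} q∈qs → divisors≥7 q (All.lookup qsPrime q∈qs) (subst (q ∣_) Πqs≡n (∈⇒∣product q∈qs))
  qsUnique : Unique qs
  qsUnique = squarefree⇒Unique qsPrime (λ p pp → squarefree p pp ∘ subst (p * p ∣_) Πqs≡n)
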